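{- There exists a streaming certification scheme for $\mathrm{MaxMatching}_{\leq}$ with certificate size $O(n)$ bits and verifier's space complexity $O(n\log n)$ bits on $n$-node graphs.
   Context: Inputs are an $n$-node graph $G$ on vertex set $[n]$ together with an integer threshold $k$; the threshold $k$ is given first, and then the edges of $G$ arrive as a stream in an arbitrary, possibly adversarial, order. A streaming certification scheme for a decision problem $P$ consists of a prover and a verifier. The prover is a computationally unlimited function which, for each input, produces a certificate $c\in\{0,1\}^*$ depending only on the input (not on the order of the edges). The verifier is a deterministic streaming algorithm with read-only access to $c$ that processes the edge stream and outputs accept or reject at the end. Completeness: if the input satisfies $P$, there is a certificate $c$ such that for every edge order the verifier accepts. Soundness: if the input does not satisfy $P$, then for every certificate $c$ and every edge order the verifier rejects. The verifier's space complexity excludes the read-only certificate. $\mathrm{MaxMatching}_{\leq}$ asks whether the maximum matching of $G$ has size at most $k$. -}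

module Defs where

open import Data.Nat using (ℕ; _≤_; _<_; _*_)
open import Data.Nat.Logarithm using (⌈log₂_⌉)
open import Data.Bool using (Bool; true; false)
open import Data.Fin using (Fin; toℕ)
open import Data.List using (List; length; foldl; concatMap; _∷_; [])
open import Data.List.Relation.Unary.All using (All)
open import Data.List.Relation.Unary.Unique.Propositional using (Unique)
open import Data.List.Membership.Propositional using (_∈_)
open import Data.Product using (_×_; _,_; Σ; proj₁; proj₂)
open import Data.Vec using (Vec)
open import Relation.Binary.PropositionalEquality using (_≡_)
open import Relation.Nullary using (¬_)

record SimpleGraph (n : ℕ) : Set where
  field
    adj    : Fin n → Fin n → Bool
    sym    : ∀ u v → adj u v ≡ adj v u
    irrefl : ∀ u → adj u u ≡ false
open SimpleGraph public

-- An edge {u,v} is written canonically as the pair (u , v) with u < v.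
Pair : ℕ → Set
Pair n = Fin n × Fin n

IsEdge : ∀ {n} → SimpleGraph n → Pair n → Set
IsEdge G (u , v) = (toℕ u < toℕ v) × (adj G u v ≡ true)

IsEdgeStream : ∀ {n} → SimpleGraph n → List (Pair n) → Set
IsEdgeStream G σ =
  All (IsEdge G) σ × Unique σ × (∀ e → IsEdge G e → e ∈ σ)

endpoints : ∀ {n} → List (Pair n) → List (Fin n)
endpoints = concatMap (λ e → proj₁ e ∷ proj₂ e ∷ [])

IsMatching : ∀ {n} → SimpleGraph n → List (Pair n) → Set
IsMatching G M = All (IsEdge G) M × Unique (endpoints M)

MaxMatchingLE : ∀ {n} → SimpleGraph n → ℕ → Set
MaxMatchingLE G k = ∀ M → IsMatching G M → length M ≤ k

Certificate : Set
Certificate = List Bool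

-- It reads k first (init), then each edge of the stream
-- (step); it has read-only access to the certificate throughout.
record Verifier (n s : ℕ) : Set where
  field
    init   : ℕ → Certificate → Vec Bool s
    step   : Certificate → Vec Bool s → Pair n → Vec Bool s
    accept : Certificate → Vec Bool s → Bool
open Verifier public

run : ∀ {n s} → Verifier n s → ℕ → Certificate → List (Pair n) → Bool
run V k c σ = accept V c (foldl (step V c) (init V k c) σ)

record Scheme (n s b : ℕ) : Set where
  field
    verifier : Verifier n s
    prover   : ℕ → SimpleGraph n → Certificate
    certSize : ∀ k G → length (prover k G) ≤ b
    complete : ∀ k (G : SimpleGraph n) → MaxMatchingLE G k →
               ∀ σ → IsEdgeStream G σ → run verifier k (prover k G) σ ≡ true
    sound    : ∀ k (G : SimpleGraph n) → ¬ MaxMatchingLE G k →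
               ∀ c σ → IsEdgeStream G σ → run verifier k c σ ≡ false

StreamingCertO : Set
StreamingCertO =
  Σ ℕ λ C → Σ ℕ λ N₀ → ∀ n → N₀ ≤ n →
    Scheme n (C * n * ⌈log₂ n ⌉) (C * n)

-- The certificate is a Tutte–Berge barrier U, written as n bits. While the edges stream by, the verifier
-- keeps k capped at n and a labelling of the vertices (n labels of ⌈log₂ n⌉ bits) that merges label
-- classes along every edge avoiding U; at the end the classes are the components of G − U, and it accepts
-- iff n + |U| ≤ 2k + odd(G − U).
-- Soundness is weak duality: a matching leaves unmatched, or matches into U, some vertex of every odd
-- component of G − U. Completeness is the Tutte–Berge formula, proved by induction on the vertex set:
-- either deleting some vertex v lowers the matching number, and v joins the barrier of G − v, or every
-- vertex is missed by some maximum matching; then Gallai's alternating-path exchange shows that a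
-- maximum matching leaves no two connected vertices unmatched, so each lies in its own odd component.

module Submission where

open import Defs renaming (sym to adj-sym)
open import Data.Nat using (ℕ; zero; suc; _+_; _*_; _∸_; _≤_; _<_; z≤n; s≤s; s≤s⁻¹; _^_; _<?_; _≤?_; _<ᵇ_; _⊓_; ⌈_/2⌉; ⌊_/2⌋)
open import Data.Nat.Properties hiding (_≟_; suc-injective)
open import Data.Nat.Logarithm using (⌈log₂_⌉; ⌈log₂⌉-mono-≤; ⌈log₂⌈n/2⌉⌉≡⌈log₂n⌉∸1; ⌈log₂2^n⌉≡n)
open import Data.Bool using (Bool; true; false; _∧_; _∨_; not; if_then_else_; T)
open import Data.Unit using (tt)
open import Data.Bool.Properties using (∧-conicalˡ; ∧-conicalʳ; ∧-identityʳ; ∧-zeroʳ; not-involutive; ¬-not)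
open import Data.Fin using (Fin; zero; suc; toℕ; fromℕ<)
open import Data.Fin.Properties using (_≟_; suc-injective; toℕ-injective; toℕ<n; fromℕ<-toℕ; toℕ-fromℕ<)
open import Data.Maybe using (Maybe; just; nothing; is-just; is-nothing; fromMaybe)
open import Data.Maybe.Properties using (just-injective)
open import Data.Product using (Σ; _×_; _,_; proj₁; proj₂)
open import Data.Sum using (_⊎_; inj₁; inj₂; map₂)
open import Data.Empty using (⊥-elim)
open import Data.List using (List; []; _∷_; _++_; length; foldl; cartesianProduct; allFin) renaming (tabulate to ltabulate)
open import Data.List.Properties using (++-assoc; length-++; length-tabulate)
open import Data.List.Relation.Unary.Any using (here; there)
open import Data.List.Relation.Unary.All using ([]; _∷_) renaming (lookup to All-lookup)
open import Data.List.Relation.Unary.All.Properties using (¬Any⇒All¬; All¬⇒¬Any)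
open import Data.List.Relation.Unary.AllPairs using ([]; _∷_)
open import Data.List.Relation.Unary.Unique.Propositional using (Unique)
open import Data.List.Membership.Propositional using (_∈_)
open import Data.List.Membership.Propositional.Properties using (∈-allFin; ∈-cartesianProduct⁺)
open import Data.Vec using (Vec; []; _∷_; lookup; tabulate) renaming (map to vmap; toList to vtoList)
open import Data.Vec.Properties using (lookup-map; lookup∘tabulate)
open import Function using (_∘_; id)
open import Relation.Nullary using (¬_; Dec; yes; no; does)
open import Relation.Nullary.Decidable using (dec-true; dec-false)
open import Relation.Binary using (tri<; tri≈; tri>)
open import Relation.Binary.PropositionalEquality
open import Relation.Binary.Construct.Closure.ReflexiveTransitive using (Star; ε; _◅_; _◅◅_; reverse)
open import Algebra.Properties.CommutativeSemigroup +-commutativeSemigroup using () renaming (interchange to +-interchange)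

-- Counting subsets of Fin n
VertexSet : ℕ → Set
VertexSet n = Fin n → Bool

_∖_ : ∀ {n} → VertexSet n → VertexSet n → VertexSet n
(S ∖ U) x = S x ∧ not (U x)

bit : Bool → ℕ
bit true  = 1
bit false = 0

∧-elim : ∀ {a b} → a ∧ b ≡ true → (a ≡ true) × (b ≡ true)
∧-elim {a} {b} h = ∧-conicalˡ a b h , ∧-conicalʳ a b h

∧-intro : ∀ {a b} → a ≡ true → b ≡ true → a ∧ b ≡ true
∧-intro refl refl = refl

not-true : ∀ {a} → not a ≡ true → a ≡ false
not-true {false} _ = refl

true≢false : true ≢ false
true≢false ()

_=ᶠ_ : ∀ {n} → Fin n → Fin n → Bool
x =ᶠ y = does (x ≟ y)

=ᶠ-refl : ∀ {n} (x : Fin n) → (x =ᶠ x) ≡ true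
=ᶠ-refl x = dec-true (x ≟ x) refl

=ᶠ-≢ : ∀ {n} {x y : Fin n} → x ≢ y → (x =ᶠ y) ≡ false
=ᶠ-≢ {x = x} {y} = dec-false (x ≟ y)

=ᶠ-sound : ∀ {n} {x y : Fin n} → (x =ᶠ y) ≡ true → x ≡ y
=ᶠ-sound {x = x} {y} h with x ≟ y
... | yes x≡y = x≡y

=ᶠ-false : ∀ {n} {x y : Fin n} → (x =ᶠ y) ≡ false → x ≢ y
=ᶠ-false {x = x} h refl = true≢false (trans (sym (=ᶠ-refl x)) h)

count : ∀ {n} → VertexSet n → ℕ
count {zero}  P = 0
count {suc n} P = bit (P zero) + count (P ∘ suc)

remove : ∀ {n} → VertexSet n → Fin n → VertexSet n
remove P a y = P y ∧ not (y =ᶠ a)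

remove-intro : ∀ {n} (P : VertexSet n) a y → P y ≡ true → y ≢ a → remove P a y ≡ true
remove-intro P a y Py y≢a rewrite Py | =ᶠ-≢ y≢a = refl

remove-elim : ∀ {n} (P : VertexSet n) a y → remove P a y ≡ true → (P y ≡ true) × (y ≢ a)
remove-elim P a y h with ∧-elim {P y} h
... | Py , a≢y = Py , =ᶠ-false (not-true a≢y)

first : ∀ {n} → VertexSet n → Maybe (Fin n)
first {zero}  P = nothing
first {suc n} P with P zero | first (P ∘ suc)
... | true  | _       = just zero
... | false | just z  = just (suc z)
... | false | nothing = nothing

first-just : ∀ {n} (P : VertexSet n) {z} → first P ≡ just z → P z ≡ true
first-just {suc n} P h with P zero in P0 | first (P ∘ suc) in eq
first-just {suc n} P refl | true  | _      = P0
first-just {suc n} P refl | false | just z = first-just (P ∘ suc) eq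

first-nothing : ∀ {n} (P : VertexSet n) → first P ≡ nothing → ∀ x → P x ≡ false
first-nothing {suc n} P h x with P zero in P0 | first (P ∘ suc) in eq
first-nothing {suc n} P () x       | true  | _
first-nothing {suc n} P () x       | false | just _
first-nothing {suc n} P h zero     | false | nothing = P0
first-nothing {suc n} P h (suc x)  | false | nothing = first-nothing (P ∘ suc) eq x

first-cong : ∀ {n} (P Q : VertexSet n) → (∀ x → P x ≡ Q x) → first P ≡ first Q
first-cong {zero}  P Q e = refl
first-cong {suc n} P Q e rewrite e zero | first-cong (P ∘ suc) (Q ∘ suc) (e ∘ suc) = refl

find : ∀ {n} (P : VertexSet n) → (Σ (Fin n) λ z → P z ≡ true) ⊎ (∀ x → P x ≡ false)
find P with first P in eq
... | just z  = inj₁ (z , first-just P eq)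
... | nothing = inj₂ (first-nothing P eq)

count-cong : ∀ {n} (P Q : VertexSet n) → (∀ x → P x ≡ Q x) → count P ≡ count Q
count-cong {zero}  P Q e = refl
count-cong {suc n} P Q e = cong₂ _+_ (cong bit (e zero)) (count-cong (P ∘ suc) (Q ∘ suc) (e ∘ suc))

count-mono : ∀ {n} (P Q : VertexSet n) → (∀ x → P x ≡ true → Q x ≡ true) → count P ≤ count Q
count-mono {zero}  P Q h = z≤n
count-mono {suc n} P Q h = +-mono-≤ (bit-mono (h zero)) (count-mono (P ∘ suc) (Q ∘ suc) (h ∘ suc))
  where
  bit-mono : ∀ {a b} → (a ≡ true → b ≡ true) → bit a ≤ bit b
  bit-mono {false} _ = z≤n
  bit-mono {true}  h rewrite h refl = ≤-refl

count≤n : ∀ {n} (P : VertexSet n) → count P ≤ n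
count≤n {zero}  P = z≤n
count≤n {suc n} P = +-mono-≤ (bit≤1 (P zero)) (count≤n (P ∘ suc))
  where
  bit≤1 : ∀ b → bit b ≤ 1
  bit≤1 true  = ≤-refl
  bit≤1 false = z≤n

count-const-true : ∀ {n} → count {n} (λ _ → true) ≡ n
count-const-true {zero}  = refl
count-const-true {suc n} = cong suc (count-const-true {n})

count-all-false : ∀ {n} (P : VertexSet n) → (∀ x → P x ≡ false) → count P ≡ 0
count-all-false {zero}  P h = refl
count-all-false {suc n} P h rewrite h zero = count-all-false (P ∘ suc) (h ∘ suc)

count-const-false : ∀ {n} → count {n} (λ _ → false) ≡ 0
count-const-false {n} = count-all-false {n} (λ _ → false) (λ _ → refl)

count-update : ∀ {n} (P Q : VertexSet n) a → (∀ y → y ≢ a → P y ≡ Q y) →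
               count P + bit (Q a) ≡ count Q + bit (P a)
count-update {suc n} P Q zero h
  rewrite count-cong (P ∘ suc) (Q ∘ suc) (λ y → h (suc y) (λ ()))
  = rearrange (bit (P zero)) (count (Q ∘ suc)) (bit (Q zero))
  where
  rearrange : ∀ a b c → a + b + c ≡ c + b + a
  rearrange a b c rewrite +-assoc a b c | +-comm a (b + c) | +-comm c b = refl
count-update {suc n} P Q (suc a) h rewrite h zero (λ ()) = begin
  bit (Q zero) + count (P ∘ suc) + bit (Q (suc a))   ≡⟨ +-assoc (bit (Q zero)) _ _ ⟩
  bit (Q zero) + (count (P ∘ suc) + bit (Q (suc a))) ≡⟨ cong (bit (Q zero) +_) ih ⟩
  bit (Q zero) + (count (Q ∘ suc) + bit (P (suc a))) ≡⟨ +-assoc (bit (Q zero)) _ _ ⟨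
  bit (Q zero) + count (Q ∘ suc) + bit (P (suc a))   ∎
  where
  open ≡-Reasoning
  ih = count-update (P ∘ suc) (Q ∘ suc) a (λ y y≢a → h (suc y) (y≢a ∘ suc-injective))

count-remove : ∀ {n} (P : VertexSet n) a → P a ≡ true → suc (count (remove P a)) ≡ count P
count-remove P a Pa = begin
  suc (count (remove P a))            ≡⟨ +-comm 1 _ ⟩
  count (remove P a) + bit true       ≡⟨ cong (λ b → count (remove P a) + bit b) Pa ⟨
  count (remove P a) + bit (P a)      ≡⟨ count-update (remove P a) P a agree ⟩
  count P + bit (remove P a a)        ≡⟨ cong (λ b → count P + bit b) removed ⟩
  count P + 0                         ≡⟨ +-identityʳ _ ⟩
  count P                             ∎
  where
  open ≡-Reasoning
  agree : ∀ y → y ≢ a → remove P a y ≡ P y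
  agree y y≢a rewrite =ᶠ-≢ y≢a = ∧-identityʳ (P y)
  removed : remove P a a ≡ false
  removed rewrite =ᶠ-refl a | Pa = refl

count-pos : ∀ {n} (P : VertexSet n) a → P a ≡ true → 1 ≤ count P
count-pos P a Pa = subst (1 ≤_) (count-remove P a Pa) (s≤s z≤n)

count-remove-≤ : ∀ {n} (P : VertexSet n) a {m} → P a ≡ true → count P ≤ suc m → count (remove P a) ≤ m
count-remove-≤ P a Pa le = s≤s⁻¹ (subst (_≤ _) (sym (count-remove P a Pa)) le)

InjectiveOn : ∀ {n} → VertexSet n → (Fin n → Fin n) → Set
InjectiveOn P φ = ∀ x y → P x ≡ true → P y ≡ true → φ x ≡ φ y → x ≡ y

count-≤-injection : ∀ {n} (P Q : VertexSet n) (φ : Fin n → Fin n) →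
  (∀ x → P x ≡ true → Q (φ x) ≡ true) → InjectiveOn P φ → count P ≤ count Q
count-≤-injection {n} P Q φ = go n P Q (count≤n P)
  where
  go : ∀ bound P Q → count P ≤ bound → (∀ x → P x ≡ true → Q (φ x) ≡ true) → InjectiveOn P φ →
       count P ≤ count Q
  go bound P Q le into inj with find P
  ... | inj₂ none = subst (_≤ count Q) (sym (count-all-false P none)) z≤n
  go zero P Q le into inj | inj₁ (x , Px) = ⊥-elim (1+n≰n (≤-trans (count-pos P x Px) le))
  go (suc bound) P Q le into inj | inj₁ (x , Px) =
    subst₂ _≤_ (count-remove P x Px) (count-remove Q (φ x) (into x Px)) (s≤s rest)
    where
    rest : count (remove P x) ≤ count (remove Q (φ x))
    rest = go bound (remove P x) (remove Q (φ x)) (count-remove-≤ P x Px le)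
      (λ y h → let (Py , y≢x) = remove-elim P x y h in
         remove-intro Q (φ x) (φ y) (into y Py) (λ e → y≢x (inj y x Py Px e)))
      (λ y z hy hz → inj y z (proj₁ (remove-elim P x y hy)) (proj₁ (remove-elim P x z hz)))

isOdd : ℕ → Bool
isOdd zero    = false
isOdd (suc n) = not (isOdd n)

involution-count-even : ∀ {n} (P : VertexSet n) (σ : Fin n → Fin n) →
  (∀ x → P x ≡ true → P (σ x) ≡ true) → (∀ x → P x ≡ true → σ (σ x) ≡ x) →
  (∀ x → P x ≡ true → σ x ≢ x) → isOdd (count P) ≡ false
involution-count-even {n} P σ = go n P (count≤n P)
  where
  go : ∀ bound P → count P ≤ bound → (∀ x → P x ≡ true → P (σ x) ≡ true) →
       (∀ x → P x ≡ true → σ (σ x) ≡ x) → (∀ x → P x ≡ true → σ x ≢ x) → isOdd (count P) ≡ false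
  go bound P le closed invol moves with find P
  ... | inj₂ none rewrite count-all-false P none = refl
  go zero P le closed invol moves | inj₁ (x , Px) = ⊥-elim (1+n≰n (≤-trans (count-pos P x Px) le))
  go (suc zero) P le closed invol moves | inj₁ (x , Px) =
    ⊥-elim (1+n≰n (≤-trans (subst (2 ≤_) (count-remove P x Px) (s≤s (count-pos P′ (σ x) P′σx))) le))
    where
    P′ = remove P x
    P′σx : P′ (σ x) ≡ true
    P′σx = remove-intro P x (σ x) (closed x Px) (moves x Px)
  go (suc (suc bound)) P le closed invol moves | inj₁ (x , Px) =
    subst (λ k → isOdd k ≡ false) both (trans (not-involutive _) rest)
    where
    y = σ x
    P′ = remove P x
    P″ = remove P′ y
    P′y : P′ y ≡ true
    P′y = remove-intro P x y (closed x Px) (moves x Px)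
    both : suc (suc (count P″)) ≡ count P
    both = trans (cong suc (count-remove P′ y P′y)) (count-remove P x Px)
    elim : ∀ z → P″ z ≡ true → (P z ≡ true) × (z ≢ x) × (z ≢ y)
    elim z h = let (a , z≢y) = remove-elim P′ y z h ; (Pz , z≢x) = remove-elim P x z a in Pz , z≢x , z≢y
    rest : isOdd (count P″) ≡ false
    rest = go bound P″ (count-remove-≤ P′ y P′y (count-remove-≤ P x Px le))
      (λ z h → let (Pz , z≢x , z≢y) = elim z h in
        remove-intro P′ y (σ z) (remove-intro P x (σ z) (closed z Pz)
          (λ e → z≢y (trans (sym (invol z Pz)) (cong σ e))))
          (λ e → z≢x (trans (sym (invol z Pz)) (trans (cong σ e) (invol x Px)))))
      (λ z h → invol z (proj₁ (elim z h)))
      (λ z h → moves z (proj₁ (elim z h)))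


findPair : ∀ {n} (P : Fin n → Fin n → Bool) →
  (Σ (Fin n) λ u → Σ (Fin n) λ v → P u v ≡ true) ⊎ (∀ u v → P u v ≡ false)
findPair P with find (λ u → is-just (first (P u)))
... | inj₁ (u , h) with first (P u) in eq
...   | just v = inj₁ (u , v , first-just (P u) eq)
findPair P | inj₂ none = inj₂ λ u v → first-nothing (P u) (none-for u) v
  where
  none-for : ∀ u → first (P u) ≡ nothing
  none-for u with first (P u) | none u
  ... | nothing | _ = refl

count-∨ : ∀ {n} (P Q : VertexSet n) → count (λ x → P x ∨ Q x) ≤ count P + count Q
count-∨ {zero}  P Q = z≤n
count-∨ {suc n} P Q = begin
  bit (P zero ∨ Q zero) + count (λ x → P (suc x) ∨ Q (suc x))
    ≤⟨ +-mono-≤ (bit-∨ (P zero) (Q zero)) (count-∨ (P ∘ suc) (Q ∘ suc)) ⟩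
  bit (P zero) + bit (Q zero) + (count (P ∘ suc) + count (Q ∘ suc))
    ≡⟨ +-interchange (bit (P zero)) (bit (Q zero)) _ _ ⟩
  bit (P zero) + count (P ∘ suc) + (bit (Q zero) + count (Q ∘ suc)) ∎
  where
  open ≤-Reasoning
  bit-∨ : ∀ a b → bit (a ∨ b) ≤ bit a + bit b
  bit-∨ true  b = s≤s z≤n
  bit-∨ false b = ≤-refl

count-split : ∀ {n} (P Q : VertexSet n) → count P ≡ count (λ x → P x ∧ Q x) + count (P ∖ Q)
count-split {zero}  P Q = refl
count-split {suc n} P Q = begin
  bit (P zero) + count (P ∘ suc)
    ≡⟨ cong₂ _+_ (bit-split (P zero) (Q zero)) (count-split (P ∘ suc) (Q ∘ suc)) ⟩
  bit (P∩Q zero) + bit ((P ∖ Q) zero) + (count (P∩Q ∘ suc) + count ((P ∖ Q) ∘ suc))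
    ≡⟨ +-interchange (bit (P∩Q zero)) _ _ _ ⟩
  bit (P∩Q zero) + count (P∩Q ∘ suc) + (bit ((P ∖ Q) zero) + count ((P ∖ Q) ∘ suc)) ∎
  where
  open ≡-Reasoning
  P∩Q : VertexSet (suc n)
  P∩Q x = P x ∧ Q x
  bit-split : ∀ a b → bit a ≡ bit (a ∧ b) + bit (a ∧ not b)
  bit-split true  true  = refl
  bit-split true  false = refl
  bit-split false b     = refl

-- Matchings as mate functions
just≢nothing : ∀ {A : Set} {x : A} → just x ≢ nothing
just≢nothing ()

is-nothing⇒≡nothing : ∀ {A : Set} (m : Maybe A) → is-nothing m ≡ true → m ≡ nothing
is-nothing⇒≡nothing nothing _ = refl

Mate : ℕ → Set
Mate n = Fin n → Maybe (Fin n)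

partner : ∀ {n} → Mate n → Fin n → Fin n
partner m z = fromMaybe z (m z)

partner-just : ∀ {n} (m : Mate n) {z w} → m z ≡ just w → partner m z ≡ w
partner-just m {z} h = cong (fromMaybe z) h

update : ∀ {n} → Mate n → Fin n → Maybe (Fin n) → Mate n
update m a v z = if z =ᶠ a then v else m z

update-same : ∀ {n} (m : Mate n) a v → update m a v a ≡ v
update-same m a v rewrite =ᶠ-refl a = refl

update-other : ∀ {n} (m : Mate n) a v z → z ≢ a → update m a v z ≡ m z
update-other m a v z z≢a rewrite =ᶠ-≢ z≢a = refl

-- The number of matched vertices, twice the size of the matching.
covered : ∀ {n} → Mate n → ℕ
covered m = count (is-just ∘ m)

covered-pos : ∀ {n} (m : Mate n) {a b} → m a ≡ just b → 1 ≤ covered m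
covered-pos m {a} h = count-pos (is-just ∘ m) a (cong is-just h)

covered-update : ∀ {n} (m : Mate n) a v →
  covered (update m a v) + bit (is-just (m a)) ≡ covered m + bit (is-just v)
covered-update m a v =
  subst (λ w → covered (update m a v) + bit (is-just (m a)) ≡ covered m + bit (is-just w)) (update-same m a v)
    (count-update (is-just ∘ update m a v) (is-just ∘ m) a (λ y y≢a → cong is-just (update-other m a v y y≢a)))

match : ∀ {n} → Mate n → Fin n → Fin n → Mate n
match m a b = update (update m a (just b)) b (just a)

unmatch : ∀ {n} → Mate n → Fin n → Fin n → Mate n
unmatch m x y = update (update m x nothing) y nothing

match-fst : ∀ {n} (m : Mate n) a b → a ≢ b → match m a b a ≡ just b
match-fst m a b a≢b = trans (update-other (update m a (just b)) b (just a) a a≢b) (update-same m a (just b))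

match-snd : ∀ {n} (m : Mate n) a b → match m a b b ≡ just a
match-snd m a b = update-same (update m a (just b)) b (just a)

match-other : ∀ {n} (m : Mate n) a b z → z ≢ a → z ≢ b → match m a b z ≡ m z
match-other m a b z z≢a z≢b = trans (update-other (update m a (just b)) b (just a) z z≢b) (update-other m a (just b) z z≢a)

unmatch-fst : ∀ {n} (m : Mate n) x y → unmatch m x y x ≡ nothing
unmatch-fst m x y = by-cases (x ≟ y)
  where
  by-cases : Dec (x ≡ y) → unmatch m x y x ≡ nothing
  by-cases (yes refl) = update-same (update m x nothing) x nothing
  by-cases (no x≢y)   = trans (update-other (update m x nothing) y nothing x x≢y) (update-same m x nothing)

unmatch-snd : ∀ {n} (m : Mate n) x y → unmatch m x y y ≡ nothing
unmatch-snd m x y = update-same (update m x nothing) y nothing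

unmatch-other : ∀ {n} (m : Mate n) x y z → z ≢ x → z ≢ y → unmatch m x y z ≡ m z
unmatch-other m x y z z≢x z≢y = trans (update-other (update m x nothing) y nothing z z≢y) (update-other m x nothing z z≢x)

covered-match : ∀ {n} (m : Mate n) a b → m a ≡ nothing → m b ≡ nothing → a ≢ b →
  covered (match m a b) ≡ covered m + 2
covered-match m a b ma mb a≢b = begin
  covered (match m a b)                        ≡⟨ +-identityʳ _ ⟨
  covered (match m a b) + 0                    ≡⟨ second ⟩
  covered (update m a (just b)) + 1            ≡⟨ cong (_+ 1) first′ ⟩
  covered m + 1 + 1                            ≡⟨ +-assoc (covered m) 1 1 ⟩
  covered m + 2                                ∎
  where
  open ≡-Reasoning
  first′ : covered (update m a (just b)) ≡ covered m + 1
  first′ = trans (sym (+-identityʳ _))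
    (subst (λ w → covered (update m a (just b)) + bit (is-just w) ≡ covered m + 1) ma (covered-update m a (just b)))
  second : covered (match m a b) + 0 ≡ covered (update m a (just b)) + 1
  second = subst (λ w → covered (match m a b) + bit (is-just w) ≡ covered (update m a (just b)) + 1)
    (trans (update-other m a _ b (a≢b ∘ sym)) mb) (covered-update (update m a (just b)) b (just a))

covered-unmatch : ∀ {n} (m : Mate n) x y → m x ≡ just y → m y ≡ just x → x ≢ y →
  covered (unmatch m x y) + 2 ≡ covered m
covered-unmatch m x y mx my x≢y = begin
  covered (unmatch m x y) + 2                  ≡⟨ +-assoc _ 1 1 ⟨
  covered (unmatch m x y) + 1 + 1              ≡⟨ cong (_+ 1) second ⟩
  covered (update m x nothing) + 1             ≡⟨ first′ ⟩
  covered m + 0                                ≡⟨ +-identityʳ _ ⟩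
  covered m                                    ∎
  where
  open ≡-Reasoning
  first′ : covered (update m x nothing) + 1 ≡ covered m + 0
  first′ = subst (λ w → covered (update m x nothing) + bit (is-just w) ≡ covered m + 0) mx (covered-update m x nothing)
  second : covered (unmatch m x y) + 1 ≡ covered (update m x nothing)
  second = trans (subst (λ w → covered (unmatch m x y) + bit (is-just w) ≡ covered (update m x nothing) + 0)
    (trans (update-other m x _ y (x≢y ∘ sym)) my) (covered-update (update m x nothing) y nothing)) (+-identityʳ _)

module Matchings {n : ℕ} (G : SimpleGraph n) where

  EdgeIn : VertexSet n → Fin n → Fin n → Set
  EdgeIn S x y = (S x ≡ true) × (S y ≡ true) × (adj G x y ≡ true)

  EdgeIn-sym : ∀ {S x y} → EdgeIn S x y → EdgeIn S y x
  EdgeIn-sym {x = x} {y} (Sx , Sy , xy) = Sy , Sx , trans (sym (adj-sym G x y)) xy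

  EdgeIn-≢ : ∀ {S x y} → EdgeIn S x y → x ≢ y
  EdgeIn-≢ {x = x} (_ , _ , xx) refl = true≢false (trans (sym xx) (irrefl G x))

  MatchingOn : VertexSet n → Mate n → Set
  MatchingOn S m = ∀ x y → m x ≡ just y → (m y ≡ just x) × EdgeIn S x y

  MatchingOn-mono : ∀ {S S′} m → (∀ x → S x ≡ true → S′ x ≡ true) → MatchingOn S m → MatchingOn S′ m
  MatchingOn-mono m S⊆S′ M x y h =
    let (my , (Sx , Sy , xy)) = M x y h in my , S⊆S′ x Sx , S⊆S′ y Sy , xy

  MatchingOn-empty : ∀ S → MatchingOn S (λ _ → nothing)
  MatchingOn-empty S x y ()

  MatchingOn-match : ∀ {S} m a b → MatchingOn S m → m a ≡ nothing → m b ≡ nothing → EdgeIn S a b →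
    MatchingOn S (match m a b)
  MatchingOn-match {S} m a b M ma mb ab z w h = by-cases (z ≟ b) (z ≟ a)
    where
    by-cases : Dec (z ≡ b) → Dec (z ≡ a) → (match m a b w ≡ just z) × EdgeIn S z w
    by-cases (yes refl) _ = subst (λ q → match m a z q ≡ just z × EdgeIn S z q)
      (just-injective (trans (sym (match-snd m a z)) h)) (match-fst m a z (EdgeIn-≢ ab) , EdgeIn-sym ab)
    by-cases (no _) (yes refl) = subst (λ q → match m z b q ≡ just z × EdgeIn S z q)
      (just-injective (trans (sym (match-fst m z b (EdgeIn-≢ ab))) h)) (match-snd m z b , ab)
    by-cases (no z≢b) (no z≢a) = trans (match-other m a b w (unmatched-≢ ma) (unmatched-≢ mb)) mw , zw
      where
      mw = proj₁ (M z w (trans (sym (match-other m a b z z≢a z≢b)) h))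
      zw = proj₂ (M z w (trans (sym (match-other m a b z z≢a z≢b)) h))
      unmatched-≢ : ∀ {c} → m c ≡ nothing → w ≢ c
      unmatched-≢ mc refl = just≢nothing (trans (sym mw) mc)

  MatchingOn-unmatch : ∀ {S} m x y → MatchingOn S m → m x ≡ just y → MatchingOn S (unmatch m x y)
  MatchingOn-unmatch {S} m x y M mx z w h = by-cases (z ≟ x) (z ≟ y)
    where
    by-cases : Dec (z ≡ x) → Dec (z ≡ y) → (unmatch m x y w ≡ just z) × EdgeIn S z w
    by-cases (yes refl) _ = ⊥-elim (just≢nothing (trans (sym h) (unmatch-fst m z y)))
    by-cases (no _) (yes refl) = ⊥-elim (just≢nothing (trans (sym h) (unmatch-snd m x z)))
    by-cases (no z≢x) (no z≢y) = trans (unmatch-other m x y w w≢x w≢y) mw , zw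
      where
      mw = proj₁ (M z w (trans (sym (unmatch-other m x y z z≢x z≢y)) h))
      zw = proj₂ (M z w (trans (sym (unmatch-other m x y z z≢x z≢y)) h))
      w≢x : w ≢ x
      w≢x refl = z≢y (just-injective (trans (sym mw) mx))
      w≢y : w ≢ y
      w≢y refl = z≢x (just-injective (trans (sym mw) (proj₁ (M x w mx))))

  unmatched-≢-matched : ∀ (m : Mate n) {z w u} → m z ≡ nothing → m w ≡ just u → z ≢ w
  unmatched-≢-matched m mz mw refl = just≢nothing (trans (sym mw) mz)

  matched-set-even : ∀ {S} M → MatchingOn S M → (P : VertexSet n) →
    (∀ z → P z ≡ true → Σ (Fin n) λ w → M z ≡ just w) →
    (∀ z w → P z ≡ true → M z ≡ just w → P w ≡ true) → isOdd (count P) ≡ false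
  matched-set-even M VM P matched closed = involution-count-even P (partner M) closed′ invol moves
    where
    closed′ : ∀ z → P z ≡ true → P (partner M z) ≡ true
    closed′ z Pz with matched z Pz
    ... | (w , Mz) rewrite partner-just M Mz = closed z w Pz Mz
    invol : ∀ z → P z ≡ true → partner M (partner M z) ≡ z
    invol z Pz with matched z Pz
    ... | (w , Mz) rewrite partner-just M Mz = partner-just M (proj₁ (VM z w Mz))
    moves : ∀ z → P z ≡ true → partner M z ≢ z
    moves z Pz with matched z Pz
    ... | (w , Mz) rewrite partner-just M Mz = λ e → EdgeIn-≢ (proj₂ (VM z w Mz)) (sym e)

-- Gallai's lemma
module Gallai {n : ℕ} (G : SimpleGraph n) (S : VertexSet n) (c₀ : ℕ) where
  open Matchings G

  Larger : Set
  Larger = Σ (Mate n) λ K → MatchingOn S K × c₀ < covered K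

  -- Exchanging the edges of an alternating path a –N– · –M– · –N– … –M– end: afterwards M′ misses
  -- end instead of a and N′ misses a instead of end, and neither matching has shrunk.
  record Exchanged (M N : Mate n) (a : Fin n) : Set where
    field
      end           : Fin n
      M′ N′         : Mate n
      M′-matching   : MatchingOn S M′
      M′-covered    : c₀ ≤ covered M′
      M′-end        : M′ end ≡ nothing
      M′-keeps      : ∀ z → M z ≡ nothing → z ≢ a → M′ z ≡ nothing
      N′-matching   : MatchingOn S N′
      N′-covered    : covered N ≤ covered N′
      N′-start      : N′ a ≡ nothing
      N′-keeps      : ∀ z → N z ≡ nothing → z ≢ end → N′ z ≡ nothing
      end-mate      : Fin n
      M-end         : M end ≡ just end-mate
      end-mate-mate : Fin n
      N-end-mate    : N end-mate ≡ just end-mate-mate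

  larger-by-match : ∀ M a b → MatchingOn S M → c₀ ≤ covered M → M a ≡ nothing → M b ≡ nothing →
    EdgeIn S a b → Larger
  larger-by-match M a b VM cM Ma Mb ab =
    match M a b , MatchingOn-match M a b VM Ma Mb ab ,
    subst (c₀ <_) (sym (covered-match M a b Ma Mb (EdgeIn-≢ ab)))
      (≤-trans (s≤s cM) (≤-trans (n≤1+n _) (≤-reflexive (+-comm 2 (covered M)))))

  -- One exchange step along a –N– b –M– c: ab moves into M and bc leaves it.
  module ExchangeStep (M N : Mate n) (a b c : Fin n) (VM : MatchingOn S M) (VN : MatchingOn S N)
                      (cM : c₀ ≤ covered M) (Ma : M a ≡ nothing) (Nab : N a ≡ just b) (Mbc : M b ≡ just c) where
    ab : EdgeIn S a b
    ab = proj₂ (VN a b Nab)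
    Nba : N b ≡ just a
    Nba = proj₁ (VN a b Nab)
    bc : EdgeIn S b c
    bc = proj₂ (VM b c Mbc)
    Mcb : M c ≡ just b
    Mcb = proj₁ (VM b c Mbc)
    a≢b : a ≢ b
    a≢b = EdgeIn-≢ ab
    b≢c : b ≢ c
    b≢c = EdgeIn-≢ bc
    c≢a : c ≢ a
    c≢a e = unmatched-≢-matched M Ma Mcb (sym e)
    M₀ M₁ N₁ : Mate n
    M₀ = unmatch M b c
    M₁ = match M₀ a b
    N₁ = unmatch N a b
    M₀a : M₀ a ≡ nothing
    M₀a = trans (unmatch-other M b c a a≢b (c≢a ∘ sym)) Ma
    M₁-matching : MatchingOn S M₁
    M₁-matching = MatchingOn-match M₀ a b (MatchingOn-unmatch M b c VM Mbc) M₀a (unmatch-fst M b c) ab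
    M₁-covered : covered M₁ ≡ covered M
    M₁-covered = trans (covered-match M₀ a b M₀a (unmatch-fst M b c) a≢b) (covered-unmatch M b c Mbc Mcb b≢c)
    M₁c : M₁ c ≡ nothing
    M₁c = trans (match-other M₀ a b c c≢a (b≢c ∘ sym)) (unmatch-snd M b c)
    M₁-other : ∀ z → z ≢ a → z ≢ b → z ≢ c → M₁ z ≡ M z
    M₁-other z z≢a z≢b z≢c = trans (match-other M₀ a b z z≢a z≢b) (unmatch-other M b c z z≢b z≢c)
    M₁a : M₁ a ≡ just b
    M₁a = match-fst M₀ a b a≢b
    M₁b : M₁ b ≡ just a
    M₁b = match-snd M₀ a b
    M₁-keeps : ∀ z → M z ≡ nothing → z ≢ a → M₁ z ≡ nothing
    M₁-keeps z Mz z≢a = trans (M₁-other z z≢a (unmatched-≢-matched M Mz Mbc) (unmatched-≢-matched M Mz Mcb)) Mz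
    N₁-matching : MatchingOn S N₁
    N₁-matching = MatchingOn-unmatch N a b VN Nab
    N₁-other : ∀ z → z ≢ a → z ≢ b → N₁ z ≡ N z
    N₁-other z z≢a z≢b = unmatch-other N a b z z≢a z≢b
    N₁c : N₁ c ≡ N c
    N₁c = N₁-other c c≢a (b≢c ∘ sym)
    N₁-covered : covered N₁ + 2 ≡ covered N
    N₁-covered = covered-unmatch N a b Nab Nba a≢b

    exchange-last : N c ≡ nothing → Exchanged M N a
    exchange-last Nc = record
      { end = c ; M′ = M₁ ; N′ = match N₁ b c
      ; M′-matching = M₁-matching
      ; M′-covered = subst (c₀ ≤_) (sym M₁-covered) cM
      ; M′-end = M₁c
      ; M′-keeps = M₁-keeps
      ; N′-matching = MatchingOn-match N₁ b c N₁-matching (unmatch-snd N a b) N₁c′ bc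
      ; N′-covered = ≤-reflexive (sym (trans (covered-match N₁ b c (unmatch-snd N a b) N₁c′ b≢c) N₁-covered))
      ; N′-start = trans (match-other N₁ b c a a≢b (c≢a ∘ sym)) (unmatch-fst N a b)
      ; N′-keeps = λ z Nz z≢c → trans (match-other N₁ b c z (unmatched-≢-matched N Nz Nba) z≢c)
                                      (trans (N₁-other z (unmatched-≢-matched N Nz Nab) (unmatched-≢-matched N Nz Nba)) Nz)
      ; end-mate = b ; M-end = Mcb ; end-mate-mate = a ; N-end-mate = Nba }
      where
      N₁c′ : N₁ c ≡ nothing
      N₁c′ = trans N₁c Nc

    exchange-extend : ∀ {d} → N c ≡ just d → Exchanged M₁ N₁ c → Exchanged M N a
    exchange-extend Ncd o = record
      { end = O.end ; M′ = O.M′ ; N′ = match O.N′ b c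
      ; M′-matching = O.M′-matching ; M′-covered = O.M′-covered ; M′-end = O.M′-end
      ; M′-keeps = λ z Mz z≢a → O.M′-keeps z (M₁-keeps z Mz z≢a) (unmatched-≢-matched M Mz Mcb)
      ; N′-matching = MatchingOn-match O.N′ b c O.N′-matching N′b O.N′-start bc
      ; N′-covered = ≤-trans (≤-reflexive (sym N₁-covered))
                       (≤-trans (+-monoˡ-≤ 2 O.N′-covered) (≤-reflexive (sym (covered-match O.N′ b c N′b O.N′-start b≢c))))
      ; N′-start = trans (match-other O.N′ b c a a≢b (c≢a ∘ sym)) (O.N′-keeps a (unmatch-fst N a b) (end≢a ∘ sym))
      ; N′-keeps = λ z Nz z≢end →
          trans (match-other O.N′ b c z (unmatched-≢-matched N Nz Nba) (unmatched-≢-matched N Nz Ncd))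
                (O.N′-keeps z (trans (N₁-other z (unmatched-≢-matched N Nz Nab) (unmatched-≢-matched N Nz Nba)) Nz) z≢end)
      ; end-mate = O.end-mate ; M-end = trans (sym (M₁-other O.end end≢a end≢b end≢c)) O.M-end
      ; end-mate-mate = O.end-mate-mate ; N-end-mate = trans (sym (N₁-other O.end-mate mate≢a mate≢b)) O.N-end-mate }
      where
      module O = Exchanged o
      mate≢a : O.end-mate ≢ a
      mate≢a e = unmatched-≢-matched N₁ (unmatch-fst N a b) O.N-end-mate (sym e)
      mate≢b : O.end-mate ≢ b
      mate≢b e = unmatched-≢-matched N₁ (unmatch-snd N a b) O.N-end-mate (sym e)
      end≢a : O.end ≢ a
      end≢a e = mate≢b (just-injective (trans (sym O.M-end) (trans (cong M₁ e) M₁a)))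
      end≢b : O.end ≢ b
      end≢b e = mate≢a (just-injective (trans (sym O.M-end) (trans (cong M₁ e) M₁b)))
      end≢c : O.end ≢ c
      end≢c e = just≢nothing (trans (sym O.M-end) (trans (cong M₁ e) M₁c))
      N′b : O.N′ b ≡ nothing
      N′b = O.N′-keeps b (unmatch-snd N a b) (end≢b ∘ sym)

  exchange : ∀ M N a b → MatchingOn S M → MatchingOn S N → c₀ ≤ covered M →
    M a ≡ nothing → N a ≡ just b → Larger ⊎ Exchanged M N a
  exchange M N a b = go (covered N) M N a b ≤-refl
    where
    go : ∀ bound M N a b → covered N ≤ bound → MatchingOn S M → MatchingOn S N → c₀ ≤ covered M →
         M a ≡ nothing → N a ≡ just b → Larger ⊎ Exchanged M N a
    go bound M N a b le VM VN cM Ma Nab with M b in Mb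
    ... | nothing = inj₁ (larger-by-match M a b VM cM Ma Mb (proj₂ (VN a b Nab)))
    ... | just c with N c in Nc
    ...   | nothing = inj₂ (ExchangeStep.exchange-last M N a b c VM VN cM Ma Nab Mb Nc)
    go zero M N a b le VM VN cM Ma Nab | just c | just d =
      ⊥-elim (1+n≰n (≤-trans (covered-pos N Nab) le))
    go (suc bound) M N a b le VM VN cM Ma Nab | just c | just d =
      map₂ (exchange-extend Nc)
        (go bound M₁ N₁ c d shorter M₁-matching N₁-matching (subst (c₀ ≤_) (sym M₁-covered) cM) M₁c (trans N₁c Nc))
      where
      open ExchangeStep M N a b c VM VN cM Ma Nab Mb
      shorter : covered N₁ ≤ bound
      shorter = ≤-trans (m≤m+n (covered N₁) 1)
        (s≤s⁻¹ (≤-trans (≤-reflexive (sym (+-suc (covered N₁) 1))) (≤-trans (≤-reflexive N₁-covered) le)))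

  EveryVertexMissable : Set
  EveryVertexMissable = ∀ w → S w ≡ true → Σ (Mate n) λ N → MatchingOn S N × c₀ ≤ covered N × N w ≡ nothing

  -- Walking the path u ⇝ v: at its first vertex w, a matching N missing w either augments (via uw),
  -- or the N/M exchange from u yields a new M missing w as well as v, and the walk continues from w.
  gallai : EveryVertexMissable → ∀ {u v} → Star (EdgeIn S) u v → ∀ M → MatchingOn S M → c₀ ≤ covered M →
           M u ≡ nothing → M v ≡ nothing → u ≢ v → Larger
  gallai missable ε M VM cM Mu Mv u≢v = ⊥-elim (u≢v refl)
  gallai missable {u} {v} (_◅_ {j = w} uw rest) M VM cM Mu Mv u≢v with w ≟ v
  ... | yes refl = larger-by-match M u w VM cM Mu Mv uw
  ... | no w≢v with missable w (proj₁ (proj₂ uw))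
  ...   | (N , VN , cN , Nw) with N u in Nu
  ...     | nothing = larger-by-match N u w VN cN Nu Nw uw
  ...     | just b with exchange M N u b VM VN cM Mu Nu
  ...       | inj₁ larger = larger
  ...       | inj₂ o with Exchanged.end o ≟ w
  ...         | yes end≡w = gallai missable rest O.M′ O.M′-matching O.M′-covered
                  (subst (λ q → O.M′ q ≡ nothing) end≡w O.M′-end) (O.M′-keeps v Mv (u≢v ∘ sym)) w≢v
    where module O = Exchanged o
  ...         | no end≢w = larger-by-match O.N′ u w O.N′-matching (≤-trans cN O.N′-covered) O.N′-start
                  (O.N′-keeps w Nw (end≢w ∘ sym)) uw
    where module O = Exchanged o

-- Odd components
bool-ext : ∀ {a b} → (a ≡ true → b ≡ true) → (b ≡ true → a ≡ true) → a ≡ b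
bool-ext {true}  f g = sym (f refl)
bool-ext {false} {true}  f g = g refl
bool-ext {false} {false} f g = refl

component : ∀ {n} → VertexSet n → (Fin n → Fin n → Bool) → Fin n → VertexSet n
component T R r z = T z ∧ R r z

pointsTo : ∀ {n} → Maybe (Fin n) → Fin n → Bool
pointsTo (just z) r = z =ᶠ r
pointsTo nothing  r = false

isRepresentative : ∀ {n} → VertexSet n → (Fin n → Fin n → Bool) → VertexSet n
isRepresentative T R r = pointsTo (first (component T R r)) r

isOddRepresentative : ∀ {n} → VertexSet n → (Fin n → Fin n → Bool) → VertexSet n
isOddRepresentative T R r = T r ∧ (isRepresentative T R r ∧ isOdd (count (component T R r)))

oddComponents : ∀ {n} → VertexSet n → (Fin n → Fin n → Bool) → ℕ
oddComponents T R = count (isOddRepresentative T R)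

oddComponents-cong : ∀ {n} (T T′ : VertexSet n) R → (∀ x → T x ≡ T′ x) → oddComponents T R ≡ oddComponents T′ R
oddComponents-cong T T′ R e = count-cong (isOddRepresentative T R) (isOddRepresentative T′ R) λ r →
  cong₂ _∧_ (e r) (cong₂ _∧_ (cong (λ q → pointsTo q r) (first-cong _ _ same)) (cong isOdd (count-cong _ _ same)))
  where
  same : ∀ {r} z → component T R r z ≡ component T′ R r z
  same z = cong (_∧ _) (e z)

module Components {n : ℕ} (G : SimpleGraph n) where
  open Matchings G

  IsConnectivity : VertexSet n → (Fin n → Fin n → Bool) → Set
  IsConnectivity T R = ∀ x y → T x ≡ true → T y ≡ true →
    (R x y ≡ true → Star (EdgeIn T) x y) × (Star (EdgeIn T) x y → R x y ≡ true)

  Star-mono : ∀ {T T′} → (∀ x → T x ≡ true → T′ x ≡ true) → ∀ {x y} → Star (EdgeIn T) x y → Star (EdgeIn T′) x y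
  Star-mono T⊆T′ ε = ε
  Star-mono T⊆T′ ((Tx , Ty , xy) ◅ rest) = (T⊆T′ _ Tx , T⊆T′ _ Ty , xy) ◅ Star-mono T⊆T′ rest

  IsConnectivity-cong : ∀ T T′ R → (∀ x → T x ≡ T′ x) → IsConnectivity T R → IsConnectivity T′ R
  IsConnectivity-cong T T′ R e conn x y T′x T′y =
    let (to , from) = conn x y (trans (e x) T′x) (trans (e y) T′y) in
    (λ h → Star-mono (λ z q → trans (sym (e z)) q) (to h)) , (λ p → from (Star-mono (λ z q → trans (e z) q) p))

  IsConnectivity-unique : ∀ T R R′ → IsConnectivity T R → IsConnectivity T R′ →
    ∀ x y → T x ≡ true → T y ≡ true → R x y ≡ R′ x y
  IsConnectivity-unique T R R′ conn conn′ x y Tx Ty =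
    bool-ext (λ h → proj₂ (conn′ x y Tx Ty) (proj₁ (conn x y Tx Ty) h))
             (λ h → proj₂ (conn x y Tx Ty) (proj₁ (conn′ x y Tx Ty) h))

  oddComponents-cong-relation : ∀ (T : VertexSet n) R R′ → (∀ x y → T x ≡ true → T y ≡ true → R x y ≡ R′ x y) →
    oddComponents T R ≡ oddComponents T R′
  oddComponents-cong-relation T R R′ e = count-cong _ _ λ r → by-Tr r (T r) refl
    where
    same : ∀ r → T r ≡ true → ∀ z → component T R r z ≡ component T R′ r z
    same r Tr z with T z in Tz
    ... | false = refl
    ... | true  = e r z Tr Tz
    by-Tr : ∀ r b → T r ≡ b → isOddRepresentative T R r ≡ isOddRepresentative T R′ r
    by-Tr r false Tr rewrite Tr = refl
    by-Tr r true  Tr rewrite Tr | first-cong _ _ (same r Tr) | count-cong _ _ (same r Tr) = refl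

  module Connectivity (T : VertexSet n) (R : Fin n → Fin n → Bool) (conn : IsConnectivity T R) where
    R-refl : ∀ x → T x ≡ true → R x x ≡ true
    R-refl x Tx = proj₂ (conn x x Tx Tx) ε

    R-sym : ∀ x y → T x ≡ true → T y ≡ true → R x y ≡ true → R y x ≡ true
    R-sym x y Tx Ty h = proj₂ (conn y x Ty Tx) (reverse EdgeIn-sym (proj₁ (conn x y Tx Ty) h))

    R-trans : ∀ x y z → T x ≡ true → T y ≡ true → T z ≡ true → R x y ≡ true → R y z ≡ true → R x z ≡ true
    R-trans x y z Tx Ty Tz h₁ h₂ = proj₂ (conn x z Tx Tz) (proj₁ (conn x y Tx Ty) h₁ ◅◅ proj₁ (conn y z Ty Tz) h₂)

    R-edge : ∀ x y → EdgeIn T x y → R x y ≡ true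
    R-edge x y xy = proj₂ (conn x y (proj₁ xy) (proj₁ (proj₂ xy))) (xy ◅ ε)

    component-same : ∀ x x′ → T x ≡ true → T x′ ≡ true → R x x′ ≡ true → ∀ z → component T R x z ≡ component T R x′ z
    component-same x x′ Tx Tx′ h z with T z in Tz
    ... | false = refl
    ... | true  = bool-ext (R-trans x′ x z Tx′ Tx Tz (R-sym x x′ Tx Tx′ h)) (R-trans x x′ z Tx Tx′ Tz h)

    representative : Fin n → Fin n
    representative x = fromMaybe x (first (component T R x))

    first-component : ∀ x → T x ≡ true → first (component T R x) ≡ just (representative x)
    first-component x Tx with first (component T R x) in eq
    ... | just z  = refl
    ... | nothing = ⊥-elim (true≢false (trans (sym (∧-intro Tx (R-refl x Tx))) (first-nothing _ eq x)))

    representative-T : ∀ x → T x ≡ true → T (representative x) ≡ true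
    representative-T x Tx = proj₁ (∧-elim (first-just _ (first-component x Tx)))

    representative-R : ∀ x → T x ≡ true → R x (representative x) ≡ true
    representative-R x Tx = proj₂ (∧-elim {T (representative x)} (first-just _ (first-component x Tx)))

    component-representative : ∀ x → T x ≡ true → ∀ z → component T R (representative x) z ≡ component T R x z
    component-representative x Tx = component-same (representative x) x (representative-T x Tx) Tx
      (R-sym x (representative x) Tx (representative-T x Tx) (representative-R x Tx))

    isRepresentative-representative : ∀ x → T x ≡ true → isRepresentative T R (representative x) ≡ true
    isRepresentative-representative x Tx
      rewrite first-cong _ _ (component-representative x Tx) | first-component x Tx = =ᶠ-refl (representative x)

    representative-injective : ∀ x x′ → T x ≡ true → T x′ ≡ true → representative x ≡ representative x′ → R x x′ ≡ true
    representative-injective x x′ Tx Tx′ e =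
      R-trans x (representative x) x′ Tx (representative-T x Tx) Tx′ (representative-R x Tx)
        (R-sym x′ (representative x) Tx′ (representative-T x Tx)
          (subst (λ q → R x′ q ≡ true) (sym e) (representative-R x′ Tx′)))

    representatives-equal : ∀ r r′ → T r ≡ true → T r′ ≡ true → isRepresentative T R r ≡ true →
      isRepresentative T R r′ ≡ true → R r r′ ≡ true → r ≡ r′
    representatives-equal r r′ Tr Tr′ h h′ q =
      just-injective (trans (sym (first-of r h)) (trans (first-cong _ _ (component-same r r′ Tr Tr′ q)) (first-of r′ h′)))
      where
      first-of : ∀ r → isRepresentative T R r ≡ true → first (component T R r) ≡ just r
      first-of r h with first (component T R r)
      ... | just z = cong just (=ᶠ-sound h)

    mateInOrNone : VertexSet n → Maybe (Fin n) → Bool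
    mateInOrNone U (just w) = U w
    mateInOrNone U nothing  = true

    mateIn : VertexSet n → Maybe (Fin n) → Bool
    mateIn U (just w) = U w
    mateIn U nothing  = false

    -- Every odd component of T contains a vertex that K leaves unmatched or matches into U, since
    -- otherwise K would pair up the component.
    module WeakDuality (S U : VertexSet n) (K : Mate n) (VK : MatchingOn S K)
                       (T⊆S : ∀ x → T x ≡ true → S x ≡ true)
                       (S∖T⊆U : ∀ x → S x ≡ true → T x ≡ false → U x ≡ true) where
      isWitness : VertexSet n
      isWitness z = S z ∧ mateInOrNone U (K z)

      mate-outside-U : ∀ z w → K z ≡ just w → U w ≡ false → T w ≡ true
      mate-outside-U z w Kz Uw with T w in Tw
      ... | true  = refl
      ... | false = ⊥-elim (true≢false (trans (sym (S∖T⊆U w (proj₁ (proj₂ (proj₂ (VK z w Kz)))) Tw)) Uw))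

      witnessless-even : ∀ r → T r ≡ true → (∀ z → (component T R r z ∧ isWitness z) ≡ false) →
        isOdd (count (component T R r)) ≡ false
      witnessless-even r Tr none = matched-set-even K VK (component T R r) (λ z c → let (w , Kz , _) = mate-of z c in w , Kz) closed
        where
        mate-of : ∀ z → component T R r z ≡ true → Σ (Fin n) λ w → (K z ≡ just w) × (U w ≡ false)
        mate-of z c = mate-outside (K z) not-witness
          where
          not-witness : mateInOrNone U (K z) ≡ false
          not-witness = subst₂ (λ a b → a ∧ (b ∧ mateInOrNone U (K z)) ≡ false)
                          c (T⊆S z (proj₁ (∧-elim c))) (none z)
          mate-outside : ∀ m → mateInOrNone U m ≡ false → Σ (Fin n) λ w → (m ≡ just w) × (U w ≡ false)
          mate-outside (just w) h = w , refl , h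
        closed : ∀ z w → component T R r z ≡ true → K z ≡ just w → component T R r w ≡ true
        closed z w c Kz with mate-of z c
        ... | (w′ , Kz′ , Uw′) rewrite just-injective (trans (sym Kz) Kz′) =
          let (Tz , Rrz) = ∧-elim {T z} c
              Tw = mate-outside-U z w′ Kz′ Uw′
          in ∧-intro Tw (R-trans r z w′ Tr Tz Tw Rrz (R-edge z w′ (Tz , Tw , proj₂ (proj₂ (proj₂ (VK z w′ Kz′))))))

      witness : Fin n → Fin n
      witness r = fromMaybe r (first (λ z → component T R r z ∧ isWitness z))

      witness-spec : ∀ r → isOddRepresentative T R r ≡ true → (component T R r (witness r) ∧ isWitness (witness r)) ≡ true
      witness-spec r h with first (λ z → component T R r z ∧ isWitness z) in eq
      ... | just z  = first-just _ eq
      ... | nothing = ⊥-elim (true≢false (trans (sym odd) (witnessless-even r Tr (first-nothing _ eq))))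
        where
        Tr = proj₁ (∧-elim {T r} h)
        odd = proj₂ (∧-elim {isRepresentative T R r} (proj₂ (∧-elim {T r} h)))

      witness-injective : InjectiveOn (isOddRepresentative T R) witness
      witness-injective r r′ h h′ e =
        let (Tr , q) = ∧-elim {T r} h ; (repr , _) = ∧-elim {isRepresentative T R r} q
            (Tr′ , q′) = ∧-elim {T r′} h′ ; (repr′ , _) = ∧-elim {isRepresentative T R r′} q′
            (Tz , Rrz) = ∧-elim {T (witness r)} (proj₁ (∧-elim (witness-spec r h)))
            (_ , Rr′z′) = ∧-elim {T (witness r′)} (proj₁ (∧-elim (witness-spec r′ h′)))
            Rr′z = subst (λ q → R r′ q ≡ true) (sym e) Rr′z′
        in representatives-equal r r′ Tr Tr′ repr repr′ (R-trans r (witness r) r′ Tr Tz Tr′ Rrz (R-sym r′ (witness r) Tr′ Tz Rr′z))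

      matchedIntoU-≤ : count (λ x → mateIn U (K x)) ≤ count U
      matchedIntoU-≤ = count-≤-injection _ U (partner K)
        (λ z h → let (w , Kz , Uw) = matched z h in subst (λ q → U q ≡ true) (sym (partner-just K Kz)) Uw)
        (λ z z′ h h′ e →
          let (w , Kz , _) = matched z h ; (w′ , Kz′ , _) = matched z′ h′
              w≡w′ = trans (sym (partner-just K Kz)) (trans e (partner-just K Kz′))
          in just-injective (trans (sym (proj₁ (VK z w Kz))) (trans (cong K w≡w′) (proj₁ (VK z′ w′ Kz′)))))
        where
        matched : ∀ z → mateIn U (K z) ≡ true → Σ (Fin n) λ w → (K z ≡ just w) × (U w ≡ true)
        matched z h with K z
        ... | just w = w , refl , h

      oddComponents-≤ : oddComponents T R ≤ count (S ∖ (is-just ∘ K)) + count U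
      oddComponents-≤ = begin
        oddComponents T R                          ≤⟨ count-≤-injection _ isWitness witness witness-in witness-injective ⟩
        count isWitness                            ≤⟨ count-mono isWitness _ (λ z → split (S z) (K z)) ⟩
        count (λ x → unmatched x ∨ intoU x)        ≤⟨ count-∨ unmatched intoU ⟩
        count unmatched + count intoU              ≤⟨ +-monoʳ-≤ (count unmatched) matchedIntoU-≤ ⟩
        count unmatched + count U                  ∎
        where
        open ≤-Reasoning
        unmatched intoU : VertexSet n
        unmatched = S ∖ (is-just ∘ K)
        intoU x = mateIn U (K x)
        witness-in : ∀ r → isOddRepresentative T R r ≡ true → isWitness (witness r) ≡ true
        witness-in r h = proj₂ (∧-elim {component T R r (witness r)} (witness-spec r h))
        split : ∀ s m → (s ∧ mateInOrNone U m) ≡ true → ((s ∧ is-nothing m) ∨ mateIn U m) ≡ true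
        split true (just w) h = h
        split true nothing  h = refl

    module UnmatchedSeparated (S : VertexSet n) (M : Mate n) (VM : MatchingOn S M)
                              (S⊆T : ∀ x → S x ≡ true → T x ≡ true)
                              (separated : ∀ u v → T u ≡ true → T v ≡ true → M u ≡ nothing → M v ≡ nothing →
                                           R u v ≡ true → u ≡ v) where
      unmatched-component-odd : ∀ x → T x ≡ true → M x ≡ nothing → isOdd (count (component T R x)) ≡ true
      unmatched-component-odd x Tx Mx =
        subst (λ k → isOdd k ≡ true) (count-remove (component T R x) x (∧-intro Tx (R-refl x Tx)))
          (cong not (matched-set-even M VM rest mate-of closed))
        where
        rest = remove (component T R x) x
        mate-of : ∀ z → rest z ≡ true → Σ (Fin n) λ w → M z ≡ just w
        mate-of z h with M z in Mz
        ... | just w  = w , refl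
        ... | nothing = ⊥-elim (z≢x (sym (separated x z Tx Tz Mx Mz Rxz)))
          where
          z≢x = proj₂ (remove-elim (component T R x) x z h)
          Tz  = proj₁ (∧-elim (proj₁ (remove-elim (component T R x) x z h)))
          Rxz = proj₂ (∧-elim {T z} (proj₁ (remove-elim (component T R x) x z h)))
        closed : ∀ z w → rest z ≡ true → M z ≡ just w → rest w ≡ true
        closed z w h Mz =
          let (c , _) = remove-elim (component T R x) x z h
              (Tz , Rxz) = ∧-elim {T z} c
              (Mw , zw) = VM z w Mz
              Tw = S⊆T w (proj₁ (proj₂ zw))
          in remove-intro (component T R x) x w (∧-intro Tw (R-trans x z w Tx Tz Tw Rxz (R-edge z w (Tz , Tw , proj₂ (proj₂ zw)))))
               (λ w≡x → just≢nothing (trans (sym Mw) (trans (cong M w≡x) Mx)))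

      unmatched-≤-oddComponents : count (λ x → T x ∧ is-nothing (M x)) ≤ oddComponents T R
      unmatched-≤-oddComponents = count-≤-injection _ (isOddRepresentative T R) representative
        (λ x h → let (Tx , Mx) = ∧-elim {T x} h in
           ∧-intro (representative-T x Tx) (∧-intro (isRepresentative-representative x Tx)
             (subst (λ k → isOdd k ≡ true) (sym (count-cong _ _ (component-representative x Tx)))
               (unmatched-component-odd x Tx (is-nothing⇒≡nothing (M x) Mx)))))
        (λ x x′ h h′ e →
           let (Tx , Mx) = ∧-elim {T x} h ; (Tx′ , Mx′) = ∧-elim {T x′} h′ in
           separated x x′ Tx Tx′ (is-nothing⇒≡nothing (M x) Mx) (is-nothing⇒≡nothing (M x′) Mx′)
             (representative-injective x x′ Tx Tx′ e))

-- Component labels in a stream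
Labelling : ℕ → Set
Labelling n = Vec (Fin n) n

merge : ∀ {n} → Labelling n → Fin n → Fin n → Labelling n
merge lab u v = vmap (λ l → if l =ᶠ lookup lab v then lookup lab u else l) lab

labelStep : ∀ {n} → (Pair n → Bool) → Labelling n → Pair n → Labelling n
labelStep active lab (u , v) = if active (u , v) then merge lab u v else lab

labels : ∀ {n} → (Pair n → Bool) → List (Pair n) → Labelling n
labels active = foldl (labelStep active) (tabulate id)

sameLabel : ∀ {n} → Labelling n → Fin n → Fin n → Bool
sameLabel lab x y = lookup lab x =ᶠ lookup lab y

lookup-merge : ∀ {n} (lab : Labelling n) u v x →
  lookup (merge lab u v) x ≡ (if lookup lab x =ᶠ lookup lab v then lookup lab u else lookup lab x)
lookup-merge lab u v x = lookup-map x (λ l → if l =ᶠ lookup lab v then lookup lab u else l) lab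

labelStep-same : ∀ {n} active (lab : Labelling n) e x y → lookup lab x ≡ lookup lab y →
  lookup (labelStep active lab e) x ≡ lookup (labelStep active lab e) y
labelStep-same active lab (u , v) x y h with active (u , v)
... | false = h
... | true rewrite lookup-merge lab u v x | lookup-merge lab u v y | h = refl

labelStep-joins : ∀ {n} active (lab : Labelling n) u v → active (u , v) ≡ true →
  lookup (labelStep active lab (u , v)) u ≡ lookup (labelStep active lab (u , v)) v
labelStep-joins active lab u v h rewrite h | lookup-merge lab u v u | lookup-merge lab u v v | =ᶠ-refl (lookup lab v)
  with lookup lab u =ᶠ lookup lab v
... | true  = refl
... | false = refl

foldl-same : ∀ {n} active σ (lab : Labelling n) x y → lookup lab x ≡ lookup lab y →
  lookup (foldl (labelStep active) lab σ) x ≡ lookup (foldl (labelStep active) lab σ) y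
foldl-same active []      lab x y h = h
foldl-same active (e ∷ σ) lab x y h = foldl-same active σ (labelStep active lab e) x y (labelStep-same active lab e x y h)

foldl-joins : ∀ {n} active σ (lab : Labelling n) u v → (u , v) ∈ σ → active (u , v) ≡ true →
  lookup (foldl (labelStep active) lab σ) u ≡ lookup (foldl (labelStep active) lab σ) v
foldl-joins active (e ∷ σ) lab u v (here refl) h = foldl-same active σ (labelStep active lab e) u v (labelStep-joins active lab u v h)
foldl-joins active (e ∷ σ) lab u v (there m)   h = foldl-joins active σ (labelStep active lab e) u v m h

module LabelConnectivity {n : ℕ} (G : SimpleGraph n) where
  open Matchings G
  open Components G

  LabelsReachable : VertexSet n → Labelling n → Set
  LabelsReachable T lab = ∀ x → Star (EdgeIn T) x (lookup lab x)

  labelStep-reachable : ∀ T active (lab : Labelling n) u v → (active (u , v) ≡ true → EdgeIn T u v) →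
    LabelsReachable T lab → LabelsReachable T (labelStep active lab (u , v))
  labelStep-reachable T active lab u v uv reach x with active (u , v) in act
  ... | false = reach x
  ... | true rewrite lookup-merge lab u v x with lookup lab x =ᶠ lookup lab v in same
  ...   | false = reach x
  ...   | true = subst (Star (EdgeIn T) x) (=ᶠ-sound same) (reach x)
                   ◅◅ (reverse EdgeIn-sym (reach v) ◅◅ (EdgeIn-sym (uv refl) ◅ reach u))

  labels-reachable : ∀ T active σ → (∀ e → e ∈ σ → active e ≡ true → EdgeIn T (proj₁ e) (proj₂ e)) →
    LabelsReachable T (labels active σ)
  labels-reachable T active σ edges = go σ (tabulate id) edges initial
    where
    initial : LabelsReachable T (tabulate id)
    initial x rewrite lookup∘tabulate id x = ε
    go : ∀ σ lab → (∀ e → e ∈ σ → active e ≡ true → EdgeIn T (proj₁ e) (proj₂ e)) →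
         LabelsReachable T lab → LabelsReachable T (foldl (labelStep active) lab σ)
    go []            lab edges reach = reach
    go ((u , v) ∷ σ) lab edges reach =
      go σ (labelStep active lab (u , v)) (λ e m → edges e (there m))
        (labelStep-reachable T active lab u v (edges (u , v) (here refl)) reach)

  labels-connectivity : ∀ T active σ → (∀ e → e ∈ σ → active e ≡ true → EdgeIn T (proj₁ e) (proj₂ e)) →
    (∀ x y → EdgeIn T x y → ((x , y) ∈ σ × active (x , y) ≡ true) ⊎ ((y , x) ∈ σ × active (y , x) ≡ true)) →
    IsConnectivity T (sameLabel (labels active σ))
  labels-connectivity T active σ edges complete x y Tx Ty = to , from
    where
    L = labels active σ
    reach = labels-reachable T active σ edges
    to : sameLabel L x y ≡ true → Star (EdgeIn T) x y
    to h = subst (Star (EdgeIn T) x) (=ᶠ-sound h) (reach x) ◅◅ reverse EdgeIn-sym (reach y)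
    edge-same : ∀ a b → EdgeIn T a b → lookup L a ≡ lookup L b
    edge-same a b ab with complete a b ab
    ... | inj₁ (m , o) = foldl-joins active σ (tabulate id) a b m o
    ... | inj₂ (m , o) = sym (foldl-joins active σ (tabulate id) b a m o)
    path-same : ∀ {a b} → Star (EdgeIn T) a b → lookup L a ≡ lookup L b
    path-same ε        = refl
    path-same (e ◅ p)  = trans (edge-same _ _ e) (path-same p)
    from : Star (EdgeIn T) x y → sameLabel L x y ≡ true
    from p rewrite path-same p = =ᶠ-refl (lookup L y)

  connectivity : VertexSet n → Fin n → Fin n → Bool
  connectivity T = sameLabel (labels (λ e → T (proj₁ e) ∧ (T (proj₂ e) ∧ adj G (proj₁ e) (proj₂ e)))
                                     (cartesianProduct (allFin n) (allFin n)))

  connectivity-correct : ∀ T → IsConnectivity T (connectivity T)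
  connectivity-correct T = labels-connectivity T _ _
    (λ e m h → let (Ta , r) = ∧-elim {T (proj₁ e)} h ; (Tb , ab) = ∧-elim {T (proj₂ e)} r in Ta , Tb , ab)
    (λ x y (Tx , Ty , xy) → inj₁ (∈-cartesianProduct⁺ (∈-allFin x) (∈-allFin y) , ∧-intro Tx (∧-intro Ty xy)))

-- The Tutte–Berge formula
<ᵇ-true : ∀ m n → (m <ᵇ n) ≡ true → m < n
<ᵇ-true m n h = <ᵇ⇒< m n (subst T (sym h) tt)

<ᵇ-false : ∀ m n → (m <ᵇ n) ≡ false → n ≤ m
<ᵇ-false m n h = ≮⇒≥ (λ m<n → subst T h (<⇒<ᵇ m<n))

≤⇒<ᵇ-false : ∀ m n → n ≤ m → (m <ᵇ n) ≡ false
≤⇒<ᵇ-false m n n≤m with m <ᵇ n in lt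
... | false = refl
... | true  = ⊥-elim (<⇒≱ (<ᵇ-true m n lt) n≤m)

even-<-gap : ∀ a b → isOdd a ≡ false → isOdd b ≡ false → a < b → a + 2 ≤ b
even-<-gap zero (suc zero) _ () _
even-<-gap zero (suc (suc b)) _ _ _ = s≤s (s≤s z≤n)
even-<-gap (suc zero) b () _ _
even-<-gap (suc (suc a)) (suc zero) _ _ (s≤s ())
even-<-gap (suc (suc a)) (suc (suc b)) ea eb (s≤s (s≤s a<b)) =
  s≤s (s≤s (even-<-gap a b (trans (sym (not-involutive (isOdd a))) ea) (trans (sym (not-involutive (isOdd b))) eb) a<b))

argmax : ∀ {m} (f : Fin (suc m) → ℕ) → Σ (Fin (suc m)) λ v → ∀ u → f u ≤ f v
argmax {zero}  f = zero , λ { zero → ≤-refl }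
argmax {suc m} f with argmax (f ∘ suc)
... | (v , max) with f zero ≤? f (suc v)
...   | yes le = suc v , λ { zero → le ; (suc u) → max u }
...   | no ≰   = zero , λ { zero → ≤-refl ; (suc u) → ≤-trans (max u) (<⇒≤ (≰⇒> ≰)) }

argmax-on : ∀ {n} (S : VertexSet n) (f : Fin n → ℕ) s → S s ≡ true →
  Σ (Fin n) λ v → (S v ≡ true) × (∀ u → S u ≡ true → f u ≤ f v)
argmax-on {suc m} S f s Ss = v , Sv , λ u Su → s≤s⁻¹ (subst₂ _≤_ (g-on-S u Su) (g-on-S v Sv) (max u))
  where
  g : Fin (suc m) → ℕ
  g v = if S v then suc (f v) else 0
  v = proj₁ (argmax g)
  max = proj₂ (argmax g)
  g-on-S : ∀ u → S u ≡ true → g u ≡ suc (f u)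
  g-on-S u Su rewrite Su = refl
  Sv : S v ≡ true
  Sv with S v in eq | max s
  ... | true  | _ = refl
  ... | false | le rewrite Ss = ⊥-elim (1+n≰n (≤-trans (s≤s z≤n) le))

module TutteBergeFormula {n : ℕ} (G : SimpleGraph n) where
  open Matchings G
  open Components G
  open LabelConnectivity G using (connectivity; connectivity-correct)

  covered-even : ∀ S M → MatchingOn S M → isOdd (covered M) ≡ false
  covered-even S M VM = matched-set-even M VM (is-just ∘ M) matched (λ z w _ Mz → cong is-just (proj₁ (VM z w Mz)))
    where
    matched : ∀ z → is-just (M z) ≡ true → Σ (Fin n) λ w → M z ≡ just w
    matched z h with M z
    ... | just w = w , refl

  count-matched-unmatched : ∀ S M → MatchingOn S M → count S ≡ covered M + count (S ∖ (is-just ∘ M))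
  count-matched-unmatched S M VM =
    trans (count-split S (is-just ∘ M)) (cong (_+ count (S ∖ (is-just ∘ M))) (count-cong _ _ matched-in-S))
    where
    matched-in-S : ∀ x → (S x ∧ is-just (M x)) ≡ is-just (M x)
    matched-in-S x with M x in Mx
    ... | nothing = ∧-zeroʳ (S x)
    ... | just y rewrite proj₁ (proj₂ (VM x y Mx)) = refl

  MatchingOn-remove : ∀ S K v → MatchingOn S K → K v ≡ nothing → MatchingOn (remove S v) K
  MatchingOn-remove S K v VK Kv x y h =
    let (Ky , (Sx , Sy , xy)) = VK x y h in
    Ky , remove-intro S v x Sx (λ e → just≢nothing (trans (sym h) (trans (cong K e) Kv)))
       , remove-intro S v y Sy (λ e → just≢nothing (trans (sym Ky) (trans (cong K e) Kv))) , xy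

  MatchingOn-remove-unmatched : ∀ S (M : Mate n) v → MatchingOn (remove S v) M → M v ≡ nothing
  MatchingOn-remove-unmatched S M v VM with M v in Mv
  ... | nothing = refl
  ... | just y  = ⊥-elim (proj₂ (remove-elim S v v (proj₁ (proj₂ (VM v y Mv)))) refl)

  weak-duality : ∀ S U K R → MatchingOn S K → (∀ x → U x ≡ true → S x ≡ true) → IsConnectivity (S ∖ U) R →
    covered K + oddComponents (S ∖ U) R ≤ count S + count U
  weak-duality S U K R VK U⊆S conn = begin
    covered K + oddComponents (S ∖ U) R
      ≤⟨ +-monoʳ-≤ (covered K) (Connectivity.WeakDuality.oddComponents-≤ (S ∖ U) R conn S U K VK
                                  (λ x h → proj₁ (∧-elim h)) outside-in-U) ⟩
    covered K + (count (S ∖ (is-just ∘ K)) + count U)  ≡⟨ +-assoc (covered K) _ _ ⟨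
    covered K + count (S ∖ (is-just ∘ K)) + count U    ≡⟨ cong (_+ count U) (count-matched-unmatched S K VK) ⟨
    count S + count U                                   ∎
    where
    open ≤-Reasoning
    outside-in-U : ∀ x → S x ≡ true → (S ∖ U) x ≡ false → U x ≡ true
    outside-in-U x Sx h with U x
    ... | true  = refl
    ... | false = ⊥-elim (true≢false (trans (sym Sx) (trans (sym (∧-identityʳ (S x))) h)))

  -- Equality in weak duality; tight is required for every connectivity relation of S ∖ U, so that it
  -- applies to whichever one the verifier computes.
  record IsTutteBerge (S : VertexSet n) (M : Mate n) (U : VertexSet n) : Set where
    field
      matching : MatchingOn S M
      U⊆S      : ∀ x → U x ≡ true → S x ≡ true
      tight    : ∀ R → IsConnectivity (S ∖ U) R → count S + count U ≤ covered M + oddComponents (S ∖ U) R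

  TutteBerge : VertexSet n → Set
  TutteBerge S = Σ (Mate n) λ M → Σ (VertexSet n) λ U → IsTutteBerge S M U

  IsTutteBerge-maximum : ∀ {S M U} K → IsTutteBerge S M U → MatchingOn S K → covered K ≤ covered M
  IsTutteBerge-maximum {S} {M} {U} K tb VK = +-cancelʳ-≤ (oddComponents (S ∖ U) R) (covered K) (covered M)
    (≤-trans (weak-duality S U K R VK (IsTutteBerge.U⊆S tb) conn) (IsTutteBerge.tight tb R conn))
    where
    R    = connectivity (S ∖ U)
    conn = connectivity-correct (S ∖ U)

  perfect-TutteBerge : ∀ S K → MatchingOn S K → (∀ x → (S ∖ (is-just ∘ K)) x ≡ false) → TutteBerge S
  perfect-TutteBerge S K VK none = K , (λ _ → false) , record
    { matching = VK ; U⊆S = λ _ () ; tight = λ R _ → begin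
      count S + count {n} (λ _ → false)          ≡⟨ cong (count S +_) (count-const-false {n}) ⟩
      count S + 0                                 ≡⟨ +-identityʳ _ ⟩
      count S                                     ≡⟨ count-matched-unmatched S K VK ⟩
      covered K + count (S ∖ (is-just ∘ K))      ≡⟨ cong (covered K +_) (count-all-false _ none) ⟩
      covered K + 0                               ≤⟨ +-monoʳ-≤ (covered K) z≤n ⟩
      covered K + oddComponents (S ∖ (λ _ → false)) R ∎ }
    where open ≤-Reasoning

  -- Induction on |S|: the sets remove S v carry Tutte–Berge pairs; Mbest is the largest of their matchings.
  module InductionStep (S : VertexSet n) (s : Fin n) (Ss : S s ≡ true)
                       (IH : ∀ v → S v ≡ true → TutteBerge (remove S v)) where

    -- For v outside S the candidate is a dummy whose property is vacuous.
    candidate : ∀ v → Σ (Mate n) λ M → Σ (VertexSet n) λ U → S v ≡ true → IsTutteBerge (remove S v) M U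
    candidate v with S v in Sv
    ... | true  = let (M , U , tb) = IH v Sv in M , U , λ _ → tb
    ... | false = (λ _ → nothing) , (λ _ → false) , λ h → ⊥-elim (true≢false (sym h))

    Mc : Fin n → Mate n
    Mc v = proj₁ (candidate v)
    Uc : Fin n → VertexSet n
    Uc v = proj₁ (proj₂ (candidate v))
    tb : ∀ v → S v ≡ true → IsTutteBerge (remove S v) (Mc v) (Uc v)
    tb v = proj₂ (proj₂ (candidate v))
    value : Fin n → ℕ
    value v = covered (Mc v)

    best : Σ (Fin n) λ v → (S v ≡ true) × (∀ u → S u ≡ true → value u ≤ value v)
    best = argmax-on S value s Ss
    vbest : Fin n
    vbest = proj₁ best
    Svbest : S vbest ≡ true
    Svbest = proj₁ (proj₂ best)
    value-≤ : ∀ u → S u ≡ true → value u ≤ value vbest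
    value-≤ = proj₂ (proj₂ best)
    Mbest : Mate n
    Mbest = Mc vbest
    c₀ : ℕ
    c₀ = value vbest

    remove⊆ : ∀ v x → remove S v x ≡ true → S x ≡ true
    remove⊆ v x h = proj₁ (remove-elim S v x h)
    Mc-matching : ∀ v → S v ≡ true → MatchingOn S (Mc v)
    Mc-matching v Sv = MatchingOn-mono (Mc v) (remove⊆ v) (IsTutteBerge.matching (tb v Sv))
    Mbest-matching : MatchingOn S Mbest
    Mbest-matching = Mc-matching vbest Svbest

    -- If some remove S v has a smaller maximum matching, v joins its barrier.
    extend-barrier : ∀ v → S v ≡ true → value v < c₀ → TutteBerge S
    extend-barrier v Sv smaller = Mbest , U , record { matching = Mbest-matching ; U⊆S = U⊆S ; tight = tight }
      where
      module TBv = IsTutteBerge (tb v Sv)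
      U : VertexSet n
      U x = Uc v x ∨ (x =ᶠ v)
      U⊆S : ∀ x → U x ≡ true → S x ≡ true
      U⊆S x h with Uc v x in Ux | x ≟ v
      ... | true  | _        = remove⊆ v x (TBv.U⊆S x Ux)
      ... | false | yes refl = Sv
      ... | false | no _     = ⊥-elim (true≢false (sym h))
      v∉Uc : Uc v v ≡ false
      v∉Uc with Uc v v in Uv
      ... | false = refl
      ... | true  = ⊥-elim (proj₂ (remove-elim S v v (TBv.U⊆S v Uv)) refl)
      count-U : suc (count (Uc v)) ≡ count U
      count-U = trans (cong suc (count-cong _ _ same)) (count-remove U v U-v)
        where
        U-v : U v ≡ true
        U-v rewrite =ᶠ-refl v | v∉Uc = refl
        same : ∀ x → Uc v x ≡ remove U v x
        same x = by-cases (x ≟ v)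
          where
          by-cases : Dec (x ≡ v) → Uc v x ≡ remove U v x
          by-cases (yes refl) rewrite =ᶠ-refl x | v∉Uc = refl
          by-cases (no x≢v) rewrite =ᶠ-≢ x≢v with Uc v x
          ... | true  = refl
          ... | false = refl
      rest-same : ∀ x → (S ∖ U) x ≡ (remove S v ∖ Uc v) x
      rest-same x with S x | Uc v x | x =ᶠ v
      ... | true  | true  | true  = refl
      ... | true  | true  | false = refl
      ... | true  | false | true  = refl
      ... | true  | false | false = refl
      ... | false | _     | _     = refl
      gap : value v + 2 ≤ c₀
      gap = even-<-gap (value v) c₀ (covered-even S (Mc v) (Mc-matching v Sv)) (covered-even S Mbest Mbest-matching) smaller
      tight : ∀ R → IsConnectivity (S ∖ U) R → count S + count U ≤ covered Mbest + oddComponents (S ∖ U) R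
      tight R conn = begin
        count S + count U                                      ≡⟨ cong₂ _+_ (count-remove S v Sv) count-U ⟨
        suc (count (remove S v)) + suc (count (Uc v))          ≡⟨ cong suc (+-suc _ _) ⟩
        2 + (count (remove S v) + count (Uc v))                ≤⟨ +-monoʳ-≤ 2 (TBv.tight R (IsConnectivity-cong _ _ R rest-same conn)) ⟩
        2 + (value v + oddComponents (remove S v ∖ Uc v) R)    ≡⟨ +-assoc 2 (value v) _ ⟨
        2 + value v + oddComponents (remove S v ∖ Uc v) R      ≤⟨ +-monoˡ-≤ _ (subst (_≤ c₀) (+-comm (value v) 2) gap) ⟩
        c₀ + oddComponents (remove S v ∖ Uc v) R               ≡⟨ cong (c₀ +_) (oddComponents-cong _ _ R rest-same) ⟨
        c₀ + oddComponents (S ∖ U) R                           ∎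
        where open ≤-Reasoning

    -- Otherwise every vertex of S is missed by a maximum matching. By Gallai's lemma Mbest then leaves no
    -- two connected vertices unmatched (or S has a perfect matching), and the empty barrier works.
    module AllMissable (no-smaller : ∀ v → S v ≡ true → c₀ ≤ value v) where
      missable : Gallai.EveryVertexMissable G S c₀
      missable w Sw = Mc w , Mc-matching w Sw , no-smaller w Sw ,
                      MatchingOn-remove-unmatched S (Mc w) w (IsTutteBerge.matching (tb w Sw))

      from-larger : ∀ K → MatchingOn S K → c₀ < covered K → TutteBerge S
      from-larger K VK larger with find (S ∖ (is-just ∘ K))
      ... | inj₂ none = perfect-TutteBerge S K VK none
      ... | inj₁ (v , h) = ⊥-elim (<⇒≱ larger (≤-trans K≤Mv (value-≤ v Sv)))
        where
        Sv = proj₁ (∧-elim {S v} h)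
        K≤Mv : covered K ≤ value v
        K≤Mv = IsTutteBerge-maximum K (tb v Sv)
                 (MatchingOn-remove S K v VK (is-nothing⇒≡nothing (K v) (proj₂ (∧-elim {S v} h))))

      S∖∅ : VertexSet n
      S∖∅ = S ∖ (λ _ → false)
      S∖∅⊆S : ∀ x → S∖∅ x ≡ true → S x ≡ true
      S∖∅⊆S x h = trans (sym (∧-identityʳ (S x))) h
      S⊆S∖∅ : ∀ x → S x ≡ true → S∖∅ x ≡ true
      S⊆S∖∅ x h = trans (∧-identityʳ (S x)) h
      R₀ : Fin n → Fin n → Bool
      R₀ = connectivity S∖∅
      conn₀ : IsConnectivity S∖∅ R₀
      conn₀ = connectivity-correct S∖∅

      violation : Fin n → Fin n → Bool
      violation u v = S∖∅ u ∧ (S∖∅ v ∧ (is-nothing (Mbest u) ∧ (is-nothing (Mbest v) ∧ (R₀ u v ∧ not (u =ᶠ v)))))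

      from-violation : ∀ u v → violation u v ≡ true → TutteBerge S
      from-violation u v h =
        let (Tu , h₁) = ∧-elim {S∖∅ u} h ; (Tv , h₂) = ∧-elim {S∖∅ v} h₁
            (Mu , h₃) = ∧-elim {is-nothing (Mbest u)} h₂ ; (Mv , h₄) = ∧-elim {is-nothing (Mbest v)} h₃
            (Ruv , u≢v) = ∧-elim {R₀ u v} h₄
            (K , VK , larger) = Gallai.gallai G S c₀ missable (Star-mono S∖∅⊆S (proj₁ (conn₀ u v Tu Tv) Ruv))
                                  Mbest Mbest-matching ≤-refl (is-nothing⇒≡nothing _ Mu) (is-nothing⇒≡nothing _ Mv)
                                  (=ᶠ-false (not-true u≢v))
        in from-larger K VK larger

      separated : (∀ u v → violation u v ≡ false) → ∀ u v → S∖∅ u ≡ true → S∖∅ v ≡ true →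
                  Mbest u ≡ nothing → Mbest v ≡ nothing → R₀ u v ≡ true → u ≡ v
      separated none u v Tu Tv Mu Mv Ruv with u ≟ v
      ... | yes u≡v = u≡v
      ... | no u≢v = ⊥-elim (true≢false (trans (sym is-violation) (none u v)))
        where
        is-violation : violation u v ≡ true
        is-violation rewrite Tu | Tv | Mu | Mv | Ruv | =ᶠ-≢ u≢v = refl

      from-separated : (∀ u v → violation u v ≡ false) → TutteBerge S
      from-separated none = Mbest , (λ _ → false) , record { matching = Mbest-matching ; U⊆S = λ _ () ; tight = tight }
        where
        tight : ∀ R → IsConnectivity S∖∅ R → count S + count {n} (λ _ → false) ≤ c₀ + oddComponents S∖∅ R
        tight R conn = begin
          count S + count {n} (λ _ → false)          ≡⟨ cong (count S +_) (count-const-false {n}) ⟩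
          count S + 0                                 ≡⟨ +-identityʳ (count S) ⟩
          count S                                     ≡⟨ count-matched-unmatched S Mbest Mbest-matching ⟩
          c₀ + count (S ∖ (is-just ∘ Mbest))          ≡⟨ cong (c₀ +_) (count-cong _ _ same) ⟨
          c₀ + count (S∖∅ ∖ (is-just ∘ Mbest))        ≤⟨ +-monoʳ-≤ c₀ unmatched-≤ ⟩
          c₀ + oddComponents S∖∅ R₀                     ≡⟨ cong (c₀ +_) (oddComponents-cong-relation S∖∅ R R₀
                                                            (IsConnectivity-unique S∖∅ R R₀ conn conn₀)) ⟨
          c₀ + oddComponents S∖∅ R                      ∎
          where
          open ≤-Reasoning
          same : ∀ x → (S∖∅ ∖ (is-just ∘ Mbest)) x ≡ (S ∖ (is-just ∘ Mbest)) x
          same x = cong (_∧ is-nothing (Mbest x)) (∧-identityʳ (S x))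
          unmatched-≤ : count (S∖∅ ∖ (is-just ∘ Mbest)) ≤ oddComponents S∖∅ R₀
          unmatched-≤ = Connectivity.UnmatchedSeparated.unmatched-≤-oddComponents
                          S∖∅ R₀ conn₀ S Mbest Mbest-matching S⊆S∖∅ (separated none)

      result : TutteBerge S
      result with findPair violation
      ... | inj₁ (u , v , h) = from-violation u v h
      ... | inj₂ none        = from-separated none

    tutte-berge-step : TutteBerge S
    tutte-berge-step with find (λ v → S v ∧ (value v <ᵇ c₀))
    ... | inj₁ (v , h) = extend-barrier v (proj₁ (∧-elim h)) (<ᵇ-true (value v) c₀ (proj₂ (∧-elim {S v} h)))
    ... | inj₂ none    = AllMissable.result
                           (λ v Sv → <ᵇ-false (value v) c₀ (subst (λ a → a ∧ (value v <ᵇ c₀) ≡ false) Sv (none v)))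

  tutte-berge : ∀ S → TutteBerge S
  tutte-berge S = go n S (count≤n S)
    where
    go : ∀ bound S → count S ≤ bound → TutteBerge S
    go bound S le with find S
    ... | inj₂ none = perfect-TutteBerge S (λ _ → nothing) (MatchingOn-empty S) (λ x → cong (_∧ true) (none x))
    go zero S le | inj₁ (s , Ss) = ⊥-elim (1+n≰n (≤-trans (count-pos S s Ss) le))
    go (suc bound) S le | inj₁ (s , Ss) =
      InductionStep.tutte-berge-step S s Ss (λ v Sv → go bound (remove S v) (count-remove-≤ S v Sv le))

-- Matchings as lists of edges
module ListMatchings {n : ℕ} (G : SimpleGraph n) where
  open Matchings G

  everything : VertexSet n
  everything _ = true

  toMate : List (Pair n) → Mate n
  toMate []            = λ _ → nothing
  toMate ((u , v) ∷ M) = match (toMate M) u v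

  toMate-unmatched : ∀ M x → ¬ (x ∈ endpoints M) → toMate M x ≡ nothing
  toMate-unmatched []            x h = refl
  toMate-unmatched ((u , v) ∷ M) x h =
    trans (match-other (toMate M) u v x (h ∘ here) (h ∘ there ∘ here)) (toMate-unmatched M x (h ∘ there ∘ there))

  toMate-matching : ∀ M → IsMatching G M → MatchingOn everything (toMate M) × (covered (toMate M) ≡ 2 * length M)
  toMate-matching []            _ = MatchingOn-empty everything , count-const-false {n}
  toMate-matching ((u , v) ∷ M) ((_ , uv) ∷ edges , ((u≢v ∷ u∉) ∷ (v∉ ∷ unique))) =
    MatchingOn-match (toMate M) u v (proj₁ rest) Mu Mv (refl , refl , uv) ,
    (begin
      covered (match (toMate M) u v) ≡⟨ covered-match (toMate M) u v Mu Mv u≢v ⟩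
      covered (toMate M) + 2         ≡⟨ cong (_+ 2) (proj₂ rest) ⟩
      2 * length M + 2               ≡⟨ +-comm (2 * length M) 2 ⟩
      2 + 2 * length M               ≡⟨ *-suc 2 (length M) ⟨
      2 * suc (length M)             ∎)
    where
    open ≡-Reasoning
    rest = toMate-matching M (edges , unique)
    Mu = toMate-unmatched M u (All¬⇒¬Any u∉)
    Mv = toMate-unmatched M v (All¬⇒¬Any v∉)

  orient : Fin n → Fin n → Pair n
  orient x y with toℕ x <? toℕ y
  ... | yes _ = (x , y)
  ... | no _  = (y , x)

  orient-IsEdge : ∀ x y → EdgeIn everything x y → IsEdge G (orient x y)
  orient-IsEdge x y xy with toℕ x <? toℕ y
  ... | yes x<y = x<y , proj₂ (proj₂ xy)
  ... | no  x≮y = ≤∧≢⇒< (≮⇒≥ x≮y) (λ e → EdgeIn-≢ xy (toℕ-injective (sym e))) , trans (adj-sym G y x) (proj₂ (proj₂ xy))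

  orient-both : ∀ (P : Fin n → Set) x y → P x → P y → P (proj₁ (orient x y)) × P (proj₂ (orient x y))
  orient-both P x y Px Py with toℕ x <? toℕ y
  ... | yes _ = Px , Py
  ... | no _  = Py , Px

  FromMate : Mate n → Set
  FromMate m = Σ (List (Pair n)) λ L → IsMatching G L × (covered m ≤ 2 * length L) ×
                                       (∀ z → z ∈ endpoints L → is-just (m z) ≡ true)

  fromMate : ∀ m → MatchingOn everything m → FromMate m
  fromMate m = go (covered m) m ≤-refl
    where
    go : ∀ bound m → covered m ≤ bound → MatchingOn everything m → FromMate m
    go bound m le Vm with find (is-just ∘ m)
    ... | inj₂ none = [] , ([] , []) , ≤-reflexive (count-all-false _ none) , (λ z ())
    ... | inj₁ (x , h) with m x in mx
    go zero        m le Vm | inj₁ (x , h) | just y = ⊥-elim (1+n≰n (≤-trans (count-pos _ x (cong is-just mx)) le))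
    go (suc bound) m le Vm | inj₁ (x , h) | just y =
      orient x y ∷ L , (orient-IsEdge x y xy ∷ edges , unique) , covered-≤ , endpoints-matched
      where
      my = proj₁ (Vm x y mx)
      xy = proj₂ (Vm x y mx)
      m′ = unmatch m x y
      m′-covered : covered m′ + 2 ≡ covered m
      m′-covered = covered-unmatch m x y mx my (EdgeIn-≢ xy)
      shorter : covered m′ ≤ bound
      shorter = ≤-trans (m≤m+n (covered m′) 1)
        (s≤s⁻¹ (≤-trans (≤-reflexive (sym (+-suc (covered m′) 1))) (≤-trans (≤-reflexive m′-covered) le)))
      rest = go bound m′ shorter (MatchingOn-unmatch m x y Vm mx)
      L = proj₁ rest
      edges = proj₁ (proj₁ (proj₂ rest))
      covered-L = proj₁ (proj₂ (proj₂ rest))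
      L-matched = proj₂ (proj₂ (proj₂ rest))
      unmatched-∉ : ∀ z → m′ z ≡ nothing → ¬ (z ∈ endpoints L)
      unmatched-∉ z m′z z∈L = true≢false (trans (sym (L-matched z z∈L)) (cong is-just m′z))
      fresh = orient-both (λ z → ¬ (z ∈ endpoints L)) x y
                (unmatched-∉ x (unmatch-fst m x y)) (unmatched-∉ y (unmatch-snd m x y))
      unique : Unique (endpoints (orient x y ∷ L))
      unique = ((λ p → <-irrefl (cong toℕ p) (proj₁ (orient-IsEdge x y xy))) ∷ ¬Any⇒All¬ _ (proj₁ fresh))
             ∷ (¬Any⇒All¬ _ (proj₂ fresh) ∷ proj₂ (proj₁ (proj₂ rest)))
      covered-≤ : covered m ≤ 2 * suc (length L)
      covered-≤ = subst₂ _≤_ m′-covered (trans (+-comm (2 * length L) 2) (sym (*-suc 2 (length L)))) (+-monoˡ-≤ 2 covered-L)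
      endpoints-matched : ∀ z → z ∈ endpoints (orient x y ∷ L) → is-just (m z) ≡ true
      ends-matched = orient-both (λ z → is-just (m z) ≡ true) x y (cong is-just mx) (cong is-just my)
      endpoints-matched z (here refl)         = proj₁ ends-matched
      endpoints-matched z (there (here refl)) = proj₂ ends-matched
      endpoints-matched z (there (there z∈L)) = trans (cong is-just (sym (unmatch-other m x y z z≢x z≢y))) (L-matched z z∈L)
        where
        z≢x : z ≢ x
        z≢x refl = unmatched-∉ z (unmatch-fst m x y) z∈L
        z≢y : z ≢ y
        z≢y refl = unmatched-∉ z (unmatch-snd m x y) z∈L

-- Binary encodings
1≤⌈log₂n⌉ : ∀ n → 2 ≤ n → 1 ≤ ⌈log₂ n ⌉
1≤⌈log₂n⌉ n 2≤n = subst (_≤ ⌈log₂ n ⌉) (⌈log₂2^n⌉≡n 1) (⌈log₂⌉-mono-≤ 2≤n)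

n≤2^⌈log₂n⌉ : ∀ n → n ≤ 2 ^ ⌈log₂ n ⌉
n≤2^⌈log₂n⌉ n = go n n ≤-refl
  where
  go : ∀ bound n → n ≤ bound → n ≤ 2 ^ ⌈log₂ n ⌉
  go _           zero          _  = z≤n
  go _           (suc zero)    _  = m^n>0 2 ⌈log₂ 1 ⌉
  go zero        (suc (suc k)) ()
  go (suc bound) m@(suc (suc k)) le = begin
    m                             ≡⟨ ⌊n/2⌋+⌈n/2⌉≡n m ⟨
    ⌊ m /2⌋ + ⌈ m /2⌉             ≤⟨ +-monoˡ-≤ ⌈ m /2⌉ (⌊n/2⌋≤⌈n/2⌉ m) ⟩
    ⌈ m /2⌉ + ⌈ m /2⌉             ≡⟨ cong (⌈ m /2⌉ +_) (+-identityʳ _) ⟨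
    2 * ⌈ m /2⌉                   ≤⟨ *-monoʳ-≤ 2 (go bound ⌈ m /2⌉ (s≤s⁻¹ (≤-trans (⌈n/2⌉<n k) le))) ⟩
    2 * 2 ^ ⌈log₂ ⌈ m /2⌉ ⌉       ≡⟨ cong (λ q → 2 * 2 ^ q) (⌈log₂⌈n/2⌉⌉≡⌈log₂n⌉∸1 m) ⟩
    2 * 2 ^ (⌈log₂ m ⌉ ∸ 1)       ≡⟨ double-pred ⌈log₂ m ⌉ (1≤⌈log₂n⌉ m (s≤s (s≤s z≤n))) ⟩
    2 ^ ⌈log₂ m ⌉                 ∎
    where
    open ≤-Reasoning
    double-pred : ∀ l → 1 ≤ l → 2 * 2 ^ (l ∸ 1) ≡ 2 ^ l
    double-pred (suc l) _ = refl

bit-isOdd+double-half : ∀ v → bit (isOdd v) + 2 * ⌊ v /2⌋ ≡ v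
bit-isOdd+double-half zero          = refl
bit-isOdd+double-half (suc zero)    = refl
bit-isOdd+double-half (suc (suc v)) rewrite not-involutive (isOdd v) | *-suc 2 ⌊ v /2⌋ = begin
  bit (isOdd v) + (2 + 2 * ⌊ v /2⌋)   ≡⟨ +-assoc (bit (isOdd v)) 2 _ ⟨
  bit (isOdd v) + 2 + 2 * ⌊ v /2⌋     ≡⟨ cong (_+ 2 * ⌊ v /2⌋) (+-comm (bit (isOdd v)) 2) ⟩
  2 + bit (isOdd v) + 2 * ⌊ v /2⌋     ≡⟨ cong (2 +_) (bit-isOdd+double-half v) ⟩
  2 + v                                ∎
  where open ≡-Reasoning

half-< : ∀ l v → v < 2 ^ suc l → ⌊ v /2⌋ < 2 ^ l
half-< l v v< = *-cancelˡ-< 2 ⌊ v /2⌋ (2 ^ l)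
  (≤-trans (s≤s (≤-trans (m≤n+m (2 * ⌊ v /2⌋) (bit (isOdd v))) (≤-reflexive (bit-isOdd+double-half v)))) v<)

bits : ℕ → ℕ → List Bool
bits zero    v = []
bits (suc l) v = isOdd v ∷ bits l ⌊ v /2⌋

length-bits : ∀ l v → length (bits l v) ≡ l
length-bits zero    v = refl
length-bits (suc l) v = cong suc (length-bits l ⌊ v /2⌋)

readBits : ℕ → List Bool → ℕ × List Bool
readBits zero    bs       = 0 , bs
readBits (suc l) []       = 0 , []
readBits (suc l) (b ∷ bs) = bit b + 2 * proj₁ (readBits l bs) , proj₂ (readBits l bs)

readBits-bits : ∀ l v rest → v < 2 ^ l → readBits l (bits l v ++ rest) ≡ (v , rest)
readBits-bits zero    zero    rest _        = refl
readBits-bits zero    (suc v) rest (s≤s ())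
readBits-bits (suc l) v       rest v<
  rewrite readBits-bits l ⌊ v /2⌋ rest (half-< l v v<) = cong (_, rest) (bit-isOdd+double-half v)

-- Out-of-range values are read as zero.
toFin : ∀ {k} → ℕ → Fin (suc k)
toFin {k} v with v <? suc k
... | yes v< = fromℕ< v<
... | no _   = zero

toFin-toℕ : ∀ {k} (x : Fin (suc k)) → toFin (toℕ x) ≡ x
toFin-toℕ {k} x with toℕ x <? suc k
... | yes x< = fromℕ<-toℕ x x<
... | no x≮  = ⊥-elim (x≮ (toℕ<n x))

pad : ∀ s → List Bool → Vec Bool s
pad zero    xs       = []
pad (suc s) []       = false ∷ pad s []
pad (suc s) (b ∷ bs) = b ∷ pad s bs

pad-prefix : ∀ s xs → length xs ≤ s → Σ (List Bool) λ rest → vtoList (pad s xs) ≡ xs ++ rest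
pad-prefix zero    []       _         = [] , refl
pad-prefix (suc s) []       _         = vtoList (pad (suc s) []) , refl
pad-prefix (suc s) (b ∷ bs) (s≤s le) = let (rest , e) = pad-prefix s bs le in rest , cong (b ∷_) e

-- Vertices are written with L bits each, the clamped threshold with L + 1 bits.
module StateCodec (m L : ℕ) (N≤2^L : suc m ≤ 2 ^ L) where

  N : ℕ
  N = suc m

  State : Set
  State = Fin (suc N) × Labelling N

  encodeLabels : ∀ {k} → Vec (Fin N) k → List Bool
  encodeLabels []       = []
  encodeLabels (x ∷ xs) = bits L (toℕ x) ++ encodeLabels xs

  decodeLabels : ∀ k → List Bool → Vec (Fin N) k × List Bool
  decodeLabels zero    bs = [] , bs
  decodeLabels (suc k) bs =
    toFin (proj₁ (readBits L bs)) ∷ proj₁ (decodeLabels k (proj₂ (readBits L bs))) ,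
    proj₂ (decodeLabels k (proj₂ (readBits L bs)))

  decodeLabels-encode : ∀ {k} (xs : Vec (Fin N) k) rest → decodeLabels k (encodeLabels xs ++ rest) ≡ (xs , rest)
  decodeLabels-encode []       rest = refl
  decodeLabels-encode (x ∷ xs) rest
    rewrite ++-assoc (bits L (toℕ x)) (encodeLabels xs) rest
          | readBits-bits L (toℕ x) (encodeLabels xs ++ rest) (≤-trans (toℕ<n x) N≤2^L)
          | decodeLabels-encode xs rest | toFin-toℕ x = refl

  length-encodeLabels : ∀ {k} (xs : Vec (Fin N) k) → length (encodeLabels xs) ≡ k * L
  length-encodeLabels []       = refl
  length-encodeLabels (x ∷ xs) = trans (length-++ (bits L (toℕ x))) (cong₂ _+_ (length-bits L (toℕ x)) (length-encodeLabels xs))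

  encode : State → List Bool
  encode (kk , lab) = bits (suc L) (toℕ kk) ++ encodeLabels lab

  decode : List Bool → State
  decode bs = toFin (proj₁ (readBits (suc L) bs)) , proj₁ (decodeLabels N (proj₂ (readBits (suc L) bs)))

  threshold-< : ∀ (kk : Fin (suc N)) → toℕ kk < 2 ^ suc L
  threshold-< kk = ≤-trans (toℕ<n kk)
    (≤-trans (s≤s N≤2^L) (≤-trans (+-monoˡ-≤ (2 ^ L) (m^n>0 2 L)) (≤-reflexive (cong (2 ^ L +_) (sym (+-identityʳ (2 ^ L)))))))

  decode-encode : ∀ st rest → decode (encode st ++ rest) ≡ st
  decode-encode (kk , lab) rest = begin
    decode ((bits (suc L) (toℕ kk) ++ encodeLabels lab) ++ rest)
      ≡⟨ cong decode (++-assoc (bits (suc L) (toℕ kk)) (encodeLabels lab) rest) ⟩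
    decode (bits (suc L) (toℕ kk) ++ (encodeLabels lab ++ rest))
      ≡⟨ cong (λ p → toFin (proj₁ p) , proj₁ (decodeLabels N (proj₂ p)))
              (readBits-bits (suc L) (toℕ kk) (encodeLabels lab ++ rest) (threshold-< kk)) ⟩
    toFin (toℕ kk) , proj₁ (decodeLabels N (encodeLabels lab ++ rest))
      ≡⟨ cong₂ _,_ (toFin-toℕ kk) (cong proj₁ (decodeLabels-encode lab rest)) ⟩
    kk , lab ∎
    where open ≡-Reasoning

  length-encode : ∀ st → length (encode st) ≡ suc L + N * L
  length-encode (kk , lab) =
    trans (length-++ (bits (suc L) (toℕ kk))) (cong₂ _+_ (length-bits (suc L) (toℕ kk)) (length-encodeLabels lab))

-- The certification scheme
bitAt : List Bool → ℕ → Bool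
bitAt []       _       = false
bitAt (b ∷ bs) zero    = b
bitAt (b ∷ bs) (suc i) = bitAt bs i

bitAt-tabulate : ∀ {n} (P : VertexSet n) x → bitAt (ltabulate P) (toℕ x) ≡ P x
bitAt-tabulate P zero    = refl
bitAt-tabulate P (suc x) = bitAt-tabulate (P ∘ suc) x

module StreamingVerifier (m L : ℕ) (n≤2^L : suc (suc m) ≤ 2 ^ L) (1≤L : 1 ≤ L) where
  n : ℕ
  n = suc (suc m)
  space : ℕ
  space = 3 * n * L
  open StateCodec (suc m) L n≤2^L

  barrier : Certificate → VertexSet n
  barrier c x = bitAt c (toℕ x)
  outside : Certificate → VertexSet n
  outside c x = not (barrier c x)
  active : Certificate → Pair n → Bool
  active c e = outside c (proj₁ e) ∧ outside c (proj₂ e)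

  stepState : Certificate → State → Pair n → State
  stepState c (kk , lab) e = kk , labelStep (active c) lab e

  cap : ℕ → Fin (suc n)
  cap k = fromℕ< (s≤s (m⊓n≤n k n))

  accepts : Certificate → State → Bool
  accepts c (kk , lab) = not (2 * toℕ kk + oddComponents (outside c) (sameLabel lab) <ᵇ n + count (barrier c))

  length-encode-≤ : ∀ st → length (encode st) ≤ space
  length-encode-≤ st = begin
    length (encode st)              ≡⟨ length-encode st ⟩
    suc L + n * L                   ≤⟨ +-monoˡ-≤ (n * L) (+-monoˡ-≤ L 1≤L) ⟩
    L + L + n * L                   ≤⟨ +-monoˡ-≤ (n * L) (+-mono-≤ (m≤n*m L n) (≤-trans (m≤n*m L n) (m≤m+n (n * L) 0))) ⟩
    n * L + (n * L + 0) + n * L     ≡⟨ +-comm (n * L + (n * L + 0)) (n * L) ⟩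
    n * L + (n * L + (n * L + 0))   ≡⟨ *-assoc 3 n L ⟨
    space                           ∎
    where open ≤-Reasoning

  store : State → Vec Bool space
  store st = pad space (encode st)

  load : Vec Bool space → State
  load v = decode (vtoList v)

  load-store : ∀ st → load (store st) ≡ st
  load-store st = let (rest , e) = pad-prefix space (encode st) (length-encode-≤ st) in
    trans (cong decode e) (decode-encode st rest)

  verifier : Verifier n space
  verifier = record
    { init   = λ k c → store (cap k , tabulate id)
    ; step   = λ c v e → store (stepState c (load v) e)
    ; accept = λ c v → accepts c (load v) }

  run-accepts : ∀ k c σ → run verifier k c σ ≡ accepts c (cap k , labels (active c) σ)
  run-accepts k c σ = cong (accepts c) (trans (simulate σ (cap k , tabulate id)) (threshold-unchanged σ (cap k) (tabulate id)))
    where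
    simulate : ∀ σ st → load (foldl (Verifier.step verifier c) (store st) σ) ≡ foldl (stepState c) st σ
    simulate []      st = load-store st
    simulate (e ∷ σ) st = trans (cong (λ q → load (foldl (Verifier.step verifier c) (store (stepState c q e)) σ)) (load-store st))
                                (simulate σ (stepState c st e))
    threshold-unchanged : ∀ σ kk lab → foldl (stepState c) (kk , lab) σ ≡ (kk , foldl (labelStep (active c)) lab σ)
    threshold-unchanged []      kk lab = refl
    threshold-unchanged (e ∷ σ) kk lab = threshold-unchanged σ kk (labelStep (active c) lab e)

  module OnGraph (G : SimpleGraph n) where
    open Matchings G
    open Components G
    open LabelConnectivity G using (labels-connectivity)
    open TutteBergeFormula G
    open ListMatchings G

    stream-connectivity : ∀ c σ → IsEdgeStream G σ → IsConnectivity (outside c) (sameLabel (labels (active c) σ))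
    stream-connectivity c σ (edges , _ , complete) = labels-connectivity (outside c) (active c) σ active-edge stream-edge
      where
      active-edge : ∀ e → e ∈ σ → active c e ≡ true → EdgeIn (outside c) (proj₁ e) (proj₂ e)
      active-edge e e∈σ h = let (o₁ , o₂) = ∧-elim {outside c (proj₁ e)} h in o₁ , o₂ , proj₂ (All-lookup edges e∈σ)
      stream-edge : ∀ x y → EdgeIn (outside c) x y →
        ((x , y) ∈ σ × active c (x , y) ≡ true) ⊎ ((y , x) ∈ σ × active c (y , x) ≡ true)
      stream-edge x y (ox , oy , xy) with <-cmp (toℕ x) (toℕ y)
      ... | tri< x<y _ _ = inj₁ (complete (x , y) (x<y , xy) , ∧-intro ox oy)
      ... | tri> _ _ y<x = inj₂ (complete (y , x) (y<x , trans (adj-sym G y x) xy) , ∧-intro oy ox)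
      ... | tri≈ _ x≡y _ = ⊥-elim (EdgeIn-≢ (ox , oy , xy) (toℕ-injective x≡y))

    -- Opaque, so that type checking never unfolds the construction of the Tutte–Berge pair.
    opaque
      optimal : TutteBerge everything
      optimal = tutte-berge everything

    Mopt : Mate n
    Mopt = proj₁ optimal
    Uopt : VertexSet n
    Uopt = proj₁ (proj₂ optimal)
    module Opt = IsTutteBerge (proj₂ (proj₂ optimal))

    certificate : Certificate
    certificate = ltabulate Uopt

    complete : ∀ k → MaxMatchingLE G k → ∀ σ → IsEdgeStream G σ → run verifier k certificate σ ≡ true
    complete k max σ stream = trans (run-accepts k certificate σ)
      (cong not (≤⇒<ᵇ-false (2 * toℕ (cap k) + od) (n + cu)
        (subst (λ q → n + cu ≤ 2 * q + od) (sym (toℕ-fromℕ< (s≤s (m⊓n≤n k n)))) ≤-capped)))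
      where
      R  = sameLabel (labels (active certificate) σ)
      od = oddComponents (outside certificate) R
      cu = count (barrier certificate)
      barrier-opt : ∀ x → barrier certificate x ≡ Uopt x
      barrier-opt = bitAt-tabulate Uopt
      outside-opt : ∀ x → outside certificate x ≡ (everything ∖ Uopt) x
      outside-opt x = cong not (barrier-opt x)
      conn : IsConnectivity (everything ∖ Uopt) R
      conn = IsConnectivity-cong _ _ R outside-opt (stream-connectivity certificate σ stream)
      from-list = fromMate Mopt Opt.matching
      Mopt-≤ : covered Mopt ≤ 2 * k
      Mopt-≤ = ≤-trans (proj₁ (proj₂ (proj₂ from-list))) (*-monoʳ-≤ 2 (max (proj₁ from-list) (proj₁ (proj₂ from-list))))
      ≤-k : n + cu ≤ 2 * k + od
      ≤-k = begin
        n + cu                                             ≡⟨ cong₂ _+_ (count-const-true {n}) (count-cong Uopt _ (sym ∘ barrier-opt)) ⟨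
        count everything + count Uopt                      ≤⟨ Opt.tight R conn ⟩
        covered Mopt + oddComponents (everything ∖ Uopt) R ≡⟨ cong (covered Mopt +_) (oddComponents-cong _ _ R outside-opt) ⟨
        covered Mopt + od                                  ≤⟨ +-monoˡ-≤ od Mopt-≤ ⟩
        2 * k + od                                         ∎
        where open ≤-Reasoning
      ≤-n : n + cu ≤ 2 * n + od
      ≤-n = ≤-trans (+-monoʳ-≤ n (≤-trans (count≤n (barrier certificate)) (m≤m+n n 0))) (m≤m+n (2 * n) od)
      ≤-capped : n + cu ≤ 2 * (k ⊓ n) + od
      ≤-capped = subst (n + cu ≤_) (trans (sym (+-distribʳ-⊓ od (2 * k) (2 * n))) (cong (_+ od) (sym (*-distribˡ-⊓ 2 k n))))
                   (⊓-glb ≤-k ≤-n)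

    sound : ∀ k c σ → IsEdgeStream G σ → run verifier k c σ ≡ true → MaxMatchingLE G k
    sound k c σ stream accepted M isM = *-cancelˡ-≤ 2 (begin
      2 * length M             ≡⟨ proj₂ (toMate-matching M isM) ⟨
      covered K                ≤⟨ +-cancelʳ-≤ od (covered K) (2 * toℕ kk) (≤-trans dual accepted′) ⟩
      2 * toℕ kk               ≤⟨ *-monoʳ-≤ 2 (≤-trans (≤-reflexive (toℕ-fromℕ< _)) (m⊓n≤m k n)) ⟩
      2 * k                    ∎)
      where
      open ≤-Reasoning
      kk = cap k
      R  = sameLabel (labels (active c) σ)
      od = oddComponents (outside c) R
      K  = toMate M
      accepted′ : n + count (barrier c) ≤ 2 * toℕ kk + od
      accepted′ = <ᵇ-false _ _ (not-true (trans (sym (run-accepts k c σ)) accepted))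
      dual : covered K + od ≤ n + count (barrier c)
      dual = subst (λ q → covered K + od ≤ q + count (barrier c)) (count-const-true {n})
               (weak-duality everything (barrier c) K R (proj₁ (toMate-matching M isM)) (λ _ _ → refl)
                 (stream-connectivity c σ stream))

  scheme : Scheme n space (3 * n)
  scheme = record
    { verifier = verifier
    ; prover   = λ _ G → OnGraph.certificate G
    ; certSize = λ _ G → ≤-trans (≤-reflexive (length-tabulate (OnGraph.Uopt G))) (m≤m+n n _)
    ; complete = λ k G → OnGraph.complete G k
    ; sound    = λ k G ¬max c σ stream → ¬-not (λ accepted → ¬max (OnGraph.sound G k c σ stream accepted)) }

lemma6 : StreamingCertO
lemma6 = 3 , 2 , λ where
  n@(suc (suc m)) _ → StreamingVerifier.scheme m ⌈log₂ n ⌉ (n≤2^⌈log₂n⌉ n) (1≤⌈log₂n⌉ n (s≤s (s≤s z≤n)))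
  zero          ()
  (suc zero)    (s≤s ())
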